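{- Let $\mathscr{P}_{T_{\mathrm{I}}}$ be the set of all integer partitions $\lambda=\lambda_1+\lambda_2+\cdots+\lambda_\ell$ (with $\lambda_1\ge\lambda_2\ge\cdots\ge\lambda_\ell\ge 1$, the empty partition included) such that (i) $\lambda_i-\lambda_{i+2}\ge 3$ whenever both parts exist, and (ii) whenever $\lambda_i-\lambda_{i+1}\le 1$, one has $\lambda_i+\lambda_{i+1}\equiv 0\pmod 3$. For $k\in\{1,2,3\}$ let $$G_{\mathrm{I},k}(x,q)=\sum_{\lambda}x^{\sharp(\lambda)}q^{|\lambda|},$$ the sum running over partitions $\lambda\in\mathscr{P}_{T_{\mathrm{I}}}$ whose smallest part is at least $k$ (the empty partition included), where $\sharp(\lambda)$ is the number of parts and $|\lambda|$ the sum of parts. Then, as formal power series, \begin{align*} G_{\mathrm{I},1}(x,q)&=\sum_{n_1,n_2\ge 0}\frac{q^{n_1^2+3n_2^2+3n_1n_2}x^{n_1+2n_2}}{(q;q)_{n_1} (q^3;q^3)_{n_2}},\\ G_{\mathrm{I},2}(x,q)&=\sum_{n_1,n_2\ge 0}\frac{q^{n_1^2+3n_2^2+3n_1n_2+n_1+3n_2}x^{n_1+2n_2}}{(q;q)_{n_1} (q^3;q^3)_{n_2}},\\ G_{\mathrm{I},3}(x,q)&=\sum_{n_1,n_2\ge 0}\frac{q^{n_1^2+3n_2^2+3n_1n_2+2n_1+3n_2}x^{n_1+2n_2}}{(q;q)_{n_1} (q^3;q^3)_{n_2}}. \end{align*}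
   Context: $(a;q)_n=\prod_{j=0}^{n-1}(1-aq^j)$ denotes the $q$-Pochhammer symbol, with $(a;q)_0=1$. -}

module Defs where

open import Data.Bool using (Bool; true; false; _∧_; if_then_else_; T)
open import Data.Nat using (ℕ; zero; suc; _+_; _*_; _∸_; _≤_; _≤ᵇ_; _≡ᵇ_; _%_)
open import Data.Nat.Properties using (_≟_; _≤?_)
open import Data.List using (List; []; _∷_; map; upTo; filter; length)
open import Data.Nat.ListAction using (sum)
open import Data.List.Relation.Unary.All using (All)
open import Data.Product using (Σ; _×_)
open import Data.Fin using (Fin)
open import Function.Bundles using (_↔_)
open import Relation.Binary.PropositionalEquality using (_≡_)
open import Relation.Nullary.Decidable using (does)

-- Partitions in 𝒫_{T_I}
-- A partition is a list of parts λ₁ ∷ λ₂ ∷ … ∷ λ_ℓ ∷ [] (largest first).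

pairOK : ℕ → ℕ → Bool
pairOK a b = (b ≤ᵇ a) ∧ (if a ≤ᵇ b + 1 then (a + b) % 3 ≡ᵇ 0 else true)

inPT : List ℕ → Bool
inPT [] = true
inPT (a ∷ []) = 1 ≤ᵇ a
inPT (a ∷ b ∷ []) = pairOK a b ∧ inPT (b ∷ [])
inPT (a ∷ b ∷ c ∷ r) = pairOK a b ∧ (c + 3 ≤ᵇ a) ∧ inPT (b ∷ c ∷ r)

PT : ℕ → ℕ → ℕ → Set
PT k N M = Σ (List ℕ) (λ ps → T (inPT ps) × All (k ≤_) ps × length ps ≡ N × sum ps ≡ M)

-- Formal power series in q with ℕ coefficients (coefficient sequences)

Series : Set
Series = ℕ → ℕ

one : Series
one zero = 1
one (suc _) = 0

_⊛_ : Series → Series → Series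
(f ⊛ g) m = sum (map (λ i → f i * g (m ∸ i)) (upTo (suc m)))

-- 1/(1 - q^d) = Σ_{j ≥ 0} q^{d j}; coefficient of q^m = #{ j | d j = m } (d ≥ 1)
geom : ℕ → Series
geom d m = length (filter (λ j → d * j ≟ m) (upTo (suc m)))

-- 1/(q^d;q^d)_n = ∏_{j=1}^{n} 1/(1 - q^{d j})
invPoch : ℕ → ℕ → Series
invPoch d zero = one
invPoch d (suc n) = invPoch d n ⊛ geom (d * suc n)

qpow : ℕ → Series → Series
qpow e f m = if does (e ≤? m) then f (m ∸ e) else 0

-- coefficient of x^N q^M in
--   Σ_{n₁,n₂ ≥ 0} q^{ex n₁ n₂} x^{n₁ + 2 n₂} / ((q;q)_{n₁} (q³;q³)_{n₂})
-- (only the finitely many pairs with n₁ + 2 n₂ = N contribute)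
rhsCoeff : (ℕ → ℕ → ℕ) → ℕ → ℕ → ℕ
rhsCoeff ex N M =
  sum (map (λ n₂ → if 2 * n₂ ≤ᵇ N
                    then qpow (ex (N ∸ 2 * n₂) n₂) (invPoch 1 (N ∸ 2 * n₂) ⊛ invPoch 3 n₂) M
                    else 0)
           (upTo (suc N)))

-- G_{I,k}(x,q) = Σ_{n₁,n₂} … as formal power series: for all N, M the number
-- of λ ∈ 𝒫_{T_I} with smallest part ≥ k, N parts and size M equals the
-- coefficient of x^N q^M on the right-hand side.
Identity : ℕ → (ℕ → ℕ → ℕ) → Set
Identity k ex = ∀ N M → Fin (rhsCoeff ex N M) ↔ PT k N M

ex₁ ex₂ ex₃ : ℕ → ℕ → ℕ
ex₁ n₁ n₂ = n₁ * n₁ + 3 * n₂ * n₂ + 3 * n₁ * n₂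
ex₂ n₁ n₂ = n₁ * n₁ + 3 * n₂ * n₂ + 3 * n₁ * n₂ + n₁ + 3 * n₂
ex₃ n₁ n₂ = n₁ * n₁ + 3 * n₂ * n₂ + 3 * n₁ * n₂ + 2 * n₁ + 3 * n₂

module Submission where

-- Write G_k(x,q) for the generating function Σ x^{#λ} q^{|λ|} of the partitions λ in 𝒫_{T_I}
-- with all parts ≥ k, and R_{a,b}(x,q) for the double sum
--   Σ_{n₁,n₂ ≥ 0} q^{n₁² + 3n₂² + 3n₁n₂ + a n₁ + b n₂} x^{n₁ + 2n₂} / ((q;q)_{n₁} (q³;q³)_{n₂}).  We prove it together with
-- G₄ = R_{3,6}, G₅ = R_{4,9}, G₆ = R_{5,9}, by showing that both families satisfy the system
--   G₁ = G₂ + xq (G₄ + xq³ G₅ + xq² G₄),   G₂ = G₃ + xq² G₄,   G₃ = G₄ + xq³ (G₅ + xq³ G₆),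
--   G_{k+3}(x,q) = G_k(xq³,q),
-- which determines all coefficients by induction on the size (the power of q).
-- Analytic side: the recurrence 1/(q^d;q^d)_n = 1/(q^d;q^d)_{n-1} + q^{dn}/(q^d;q^d)_n gives
--   R_{a,b} = R_{a+1,b} + x q^{a+1} R_{a+2,b+3},  R_{a,b} = R_{a,b+3} + x² q^{b+3} R_{a+3,b+6},
-- and R_{a+3,b+6}(x,q) = R_{a,b}(xq³,q); these combine into the system.
-- Combinatorial side: partitions are listed smallest part first; classifying them by the
-- smallest part and the part after it gives the system, and adding 3 to every part the shift.

open import Defs
open import Data.Bool using (Bool; true; false; T; not; _∧_; if_then_else_)
open import Data.Bool.Properties using (T-≡; T-irrelevant; ∧-identityʳ; ∧-zeroʳ; ∧-assoc; ∧-comm)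
open import Data.Empty using (⊥; ⊥-elim)
open import Data.Fin using (Fin; zero)
open import Data.Fin.Properties using (+↔⊎)
open import Data.List using (List; []; _∷_; _++_; length; reverse; map; upTo; applyUpTo; filter)
open import Data.List.Properties using (length-reverse; reverse-involutive; reverse-++; unfold-reverse; length-map; map-∘; map-id; map-id-local)
open import Data.List.Relation.Binary.Permutation.Propositional using (↭-sym)
open import Data.List.Relation.Binary.Permutation.Propositional.Properties using (↭-reverse; All-resp-↭)
open import Data.List.Relation.Unary.All as All using (All; []; _∷_)
open import Data.Nat
open import Data.Nat.DivMod using ([m+kn]%n≡m%n)
open import Data.Nat.Induction using (<-rec)
open import Data.Nat.ListAction using (sum)
open import Data.Nat.ListAction.Properties using (sum-↭)
open import Data.Nat.Properties
open import Data.Nat.Tactic.RingSolver using (solve-∀)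
open import Data.Product using (Σ; _×_; _,_; proj₁)
open import Data.Sum using (_⊎_; inj₁; inj₂)
open import Data.Sum.Function.Propositional using (_⊎-↔_)
open import Data.Unit using (tt)
open import Function using (_∘_; flip)
open import Function.Bundles using (_↔_; mk↔ₛ′; Inverse; _⇔_; mk⇔; Equivalence)
open import Function.Properties.Inverse using (↔-refl; ↔-sym; ↔-trans)
open import Relation.Binary.PropositionalEquality
open import Relation.Nullary using (¬_; yes; no; contradiction)

sumBelow : ℕ → (ℕ → ℕ) → ℕ
sumBelow zero f = 0
sumBelow (suc n) f = f 0 + sumBelow n (f ∘ suc)

sum-applyUpTo : ∀ n (f g : ℕ → ℕ) → sum (map f (applyUpTo g n)) ≡ sumBelow n (f ∘ g)
sum-applyUpTo zero f g = refl
sum-applyUpTo (suc n) f g = cong (f (g 0) +_) (sum-applyUpTo n f (g ∘ suc))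

sum-upTo : ∀ n (f : ℕ → ℕ) → sum (map f (upTo n)) ≡ sumBelow n f
sum-upTo n f = sum-applyUpTo n f (λ i → i)

sumBelow-cong : ∀ n {f g : ℕ → ℕ} → (∀ i → i < n → f i ≡ g i) → sumBelow n f ≡ sumBelow n g
sumBelow-cong zero f≡g = refl
sumBelow-cong (suc n) f≡g = cong₂ _+_ (f≡g 0 z<s) (sumBelow-cong n (λ i i<n → f≡g (suc i) (s<s i<n)))

sumBelow-zero : ∀ n {f : ℕ → ℕ} → (∀ i → i < n → f i ≡ 0) → sumBelow n f ≡ 0
sumBelow-zero zero f≡0 = refl
sumBelow-zero (suc n) f≡0 = cong₂ _+_ (f≡0 0 z<s) (sumBelow-zero n (λ i i<n → f≡0 (suc i) (s<s i<n)))

sumBelow-+ : ∀ n (f g : ℕ → ℕ) → sumBelow n (λ i → f i + g i) ≡ sumBelow n f + sumBelow n g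
sumBelow-+ zero f g = refl
sumBelow-+ (suc n) f g =
  trans (cong (f 0 + g 0 +_) (sumBelow-+ n (f ∘ suc) (g ∘ suc))) (interchange (f 0) (g 0) _ _)
  where
  interchange : ∀ a b c d → a + b + (c + d) ≡ a + c + (b + d)
  interchange = solve-∀

sumBelow-split : ∀ a b (f : ℕ → ℕ) → sumBelow (a + b) f ≡ sumBelow a f + sumBelow b (λ i → f (a + i))
sumBelow-split zero b f = refl
sumBelow-split (suc a) b f = trans (cong (f 0 +_) (sumBelow-split a b (f ∘ suc))) (sym (+-assoc (f 0) _ _))

sumBelow-trunc : ∀ L k (f : ℕ → ℕ) → (∀ j → j < k → f (L + j) ≡ 0) → sumBelow (L + k) f ≡ sumBelow L f
sumBelow-trunc L k f vanish = trans (sumBelow-split L k f) (trans (cong (sumBelow L f +_) (sumBelow-zero k vanish)) (+-identityʳ _))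

sumBelow-last : ∀ n (f : ℕ → ℕ) → sumBelow (suc n) f ≡ sumBelow n f + f n
sumBelow-last zero f = +-identityʳ (f 0)
sumBelow-last (suc n) f = trans (cong (f 0 +_) (sumBelow-last n (f ∘ suc))) (sym (+-assoc (f 0) _ _))

_≈_ : Series → Series → Set
f ≈ g = ∀ m → f m ≡ g m

_⊕_ : Series → Series → Series
(f ⊕ g) m = f m + g m

conv : ∀ f g m → (f ⊛ g) m ≡ sumBelow (suc m) (λ i → f i * g (m ∸ i))
conv f g m = sum-upTo (suc m) _

⊛-cong : ∀ {f f′ g g′} → f ≈ f′ → g ≈ g′ → (f ⊛ g) ≈ (f′ ⊛ g′)
⊛-cong {f} {f′} {g} {g′} f≈f′ g≈g′ m = begin
  (f ⊛ g) m                                    ≡⟨ conv f g m ⟩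
  sumBelow (suc m) (λ i → f i * g (m ∸ i))     ≡⟨ sumBelow-cong (suc m) (λ i _ → cong₂ _*_ (f≈f′ i) (g≈g′ (m ∸ i))) ⟩
  sumBelow (suc m) (λ i → f′ i * g′ (m ∸ i))   ≡⟨ conv f′ g′ m ⟨
  (f′ ⊛ g′) m                                  ∎
  where open ≡-Reasoning

one-∸ : ∀ m i → i < m → one (m ∸ i) ≡ 0
one-∸ (suc m) zero _ = refl
one-∸ (suc m) (suc i) i<m = one-∸ m i (s<s⁻¹ i<m)

⊛-identityʳ : ∀ f → (f ⊛ one) ≈ f
⊛-identityʳ f m = begin
  (f ⊛ one) m
    ≡⟨ conv f one m ⟩
  sumBelow (suc m) (λ i → f i * one (m ∸ i))
    ≡⟨ sumBelow-last m _ ⟩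
  sumBelow m (λ i → f i * one (m ∸ i)) + f m * one (m ∸ m)
    ≡⟨ cong₂ _+_ (sumBelow-zero m only-last) (cong (λ k → f m * one k) (n∸n≡0 m)) ⟩
  f m * 1
    ≡⟨ *-identityʳ (f m) ⟩
  f m ∎
  where
  open ≡-Reasoning
  only-last : ∀ i → i < m → f i * one (m ∸ i) ≡ 0
  only-last i i<m = trans (cong (f i *_) (one-∸ m i i<m)) (*-zeroʳ (f i))

⊛-distribˡ : ∀ f g h → (f ⊛ (g ⊕ h)) ≈ ((f ⊛ g) ⊕ (f ⊛ h))
⊛-distribˡ f g h m = begin
  (f ⊛ (g ⊕ h)) m
    ≡⟨ conv f (g ⊕ h) m ⟩
  sumBelow (suc m) (λ i → f i * (g (m ∸ i) + h (m ∸ i)))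
    ≡⟨ sumBelow-cong (suc m) (λ i _ → *-distribˡ-+ (f i) (g (m ∸ i)) (h (m ∸ i))) ⟩
  sumBelow (suc m) (λ i → f i * g (m ∸ i) + f i * h (m ∸ i))
    ≡⟨ sumBelow-+ (suc m) (λ i → f i * g (m ∸ i)) (λ i → f i * h (m ∸ i)) ⟩
  sumBelow (suc m) (λ i → f i * g (m ∸ i)) + sumBelow (suc m) (λ i → f i * h (m ∸ i))
    ≡⟨ cong₂ _+_ (conv f g m) (conv f h m) ⟨
  (f ⊛ g) m + (f ⊛ h) m ∎
  where open ≡-Reasoning

⊛-distribʳ : ∀ f g h → ((f ⊕ g) ⊛ h) ≈ ((f ⊛ h) ⊕ (g ⊛ h))
⊛-distribʳ f g h m = begin
  ((f ⊕ g) ⊛ h) m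
    ≡⟨ conv (f ⊕ g) h m ⟩
  sumBelow (suc m) (λ i → (f i + g i) * h (m ∸ i))
    ≡⟨ sumBelow-cong (suc m) (λ i _ → *-distribʳ-+ (h (m ∸ i)) (f i) (g i)) ⟩
  sumBelow (suc m) (λ i → f i * h (m ∸ i) + g i * h (m ∸ i))
    ≡⟨ sumBelow-+ (suc m) (λ i → f i * h (m ∸ i)) (λ i → g i * h (m ∸ i)) ⟩
  sumBelow (suc m) (λ i → f i * h (m ∸ i)) + sumBelow (suc m) (λ i → g i * h (m ∸ i))
    ≡⟨ cong₂ _+_ (conv f h m) (conv g h m) ⟨
  (f ⊛ h) m + (g ⊛ h) m ∎
  where open ≡-Reasoning

qpow-≥ : ∀ e f {m} → e ≤ m → qpow e f m ≡ f (m ∸ e)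
qpow-≥ e f e≤m rewrite Equivalence.to T-≡ (≤⇒≤ᵇ e≤m) = refl

qpow-< : ∀ e f {m} → m < e → qpow e f m ≡ 0
qpow-< e f {m} m<e with e ≤ᵇ m in eq
... | true = contradiction (≤ᵇ⇒≤ e m (subst T (sym eq) tt)) (<⇒≱ m<e)
... | false = refl

qpow-+ : ∀ e f d → qpow e f (e + d) ≡ f d
qpow-+ e f d = trans (qpow-≥ e f (m≤m+n e d)) (cong f (m+n∸m≡n e d))

below-or-above : ∀ (P : ℕ → Set) e → (∀ m → m < e → P m) → (∀ d → P (e + d)) → ∀ m → P m
below-or-above P e below above m with e ≤? m
... | yes e≤m = subst P (m+[n∸m]≡n e≤m) (above (m ∸ e))
... | no e≰m = below m (≰⇒> e≰m)

qpow-cong : ∀ e {f g} → f ≈ g → qpow e f ≈ qpow e g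
qpow-cong e {f} {g} f≈g = below-or-above _ e
  (λ m m<e → trans (qpow-< e f m<e) (sym (qpow-< e g m<e)))
  (λ d → trans (qpow-+ e f d) (trans (f≈g d) (sym (qpow-+ e g d))))

qpow-⊕ : ∀ e f g → qpow e (f ⊕ g) ≈ (qpow e f ⊕ qpow e g)
qpow-⊕ e f g = below-or-above _ e
  (λ m m<e → trans (qpow-< e (f ⊕ g) m<e) (sym (cong₂ _+_ (qpow-< e f m<e) (qpow-< e g m<e))))
  (λ d → trans (qpow-+ e (f ⊕ g) d) (sym (cong₂ _+_ (qpow-+ e f d) (qpow-+ e g d))))

qpow-qpow : ∀ e e′ f → qpow e (qpow e′ f) ≈ qpow (e + e′) f
qpow-qpow e e′ f = below-or-above _ e
  (λ m m<e → trans (qpow-< e (qpow e′ f) m<e) (sym (qpow-< (e + e′) f (<-≤-trans m<e (m≤m+n e e′)))))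
  (λ d → trans (qpow-+ e (qpow e′ f) d) (below-or-above (λ d → qpow e′ f d ≡ qpow (e + e′) f (e + d)) e′
     (λ d d<e′ → trans (qpow-< e′ f d<e′) (sym (qpow-< (e + e′) f (+-monoʳ-< e d<e′))))
     (λ d′ → trans (qpow-+ e′ f d′) (trans (sym (qpow-+ (e + e′) f d′)) (cong (qpow (e + e′) f) (+-assoc e e′ d′))))
     d))

qpow-exp : ∀ {e e′} f → e ≡ e′ → qpow e f ≈ qpow e′ f
qpow-exp f refl m = refl

-- An exponent past all of q^e's support: the term i = d + 1 + j of (f ⊛ q^e g) at e + d vanishes.
beyond-support : ∀ e d j → j < e → (e + d) ∸ (suc d + j) < e
beyond-support (suc e) d j _ =
  s≤s (≤-trans (≤-reflexive (trans (cong (_∸ (d + j)) (+-comm e d)) ([m+n]∸[m+o]≡n∸o d e j))) (m∸n≤m e j))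

⊛-qpowʳ : ∀ e f g → (f ⊛ qpow e g) ≈ qpow e (f ⊛ g)
⊛-qpowʳ e f g = below-or-above _ e below above
  where
  open ≡-Reasoning
  below : ∀ m → m < e → (f ⊛ qpow e g) m ≡ qpow e (f ⊛ g) m
  below m m<e = begin
    (f ⊛ qpow e g) m                                   ≡⟨ conv f (qpow e g) m ⟩
    sumBelow (suc m) (λ i → f i * qpow e g (m ∸ i))    ≡⟨ sumBelow-zero (suc m) (λ i _ → vanish i) ⟩
    0                                                  ≡⟨ qpow-< e (f ⊛ g) m<e ⟨
    qpow e (f ⊛ g) m                                   ∎
    where
    vanish : ∀ i → f i * qpow e g (m ∸ i) ≡ 0
    vanish i = trans (cong (f i *_) (qpow-< e g (≤-<-trans (m∸n≤m m i) m<e))) (*-zeroʳ (f i))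
  above : ∀ d → (f ⊛ qpow e g) (e + d) ≡ qpow e (f ⊛ g) (e + d)
  above d = begin
    (f ⊛ qpow e g) (e + d)                                 ≡⟨ conv f (qpow e g) (e + d) ⟩
    sumBelow (suc (e + d)) term                            ≡⟨ cong (λ n → sumBelow (suc n) term) (+-comm e d) ⟩
    sumBelow (suc d + e) term                              ≡⟨ sumBelow-trunc (suc d) e term vanish ⟩
    sumBelow (suc d) term                                  ≡⟨ sumBelow-cong (suc d) shifted ⟩
    sumBelow (suc d) (λ i → f i * g (d ∸ i))               ≡⟨ conv f g d ⟨
    (f ⊛ g) d                                              ≡⟨ qpow-+ e (f ⊛ g) d ⟨
    qpow e (f ⊛ g) (e + d)                                 ∎
    where
    term : ℕ → ℕ
    term i = f i * qpow e g ((e + d) ∸ i)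
    vanish : ∀ j → j < e → term (suc d + j) ≡ 0
    vanish j j<e = trans (cong (f (suc d + j) *_) (qpow-< e g (beyond-support e d j j<e))) (*-zeroʳ (f (suc d + j)))
    shifted : ∀ i → i < suc d → term i ≡ f i * g (d ∸ i)
    shifted i i≤d = cong (f i *_) (trans (cong (qpow e g) (+-∸-assoc e (s≤s⁻¹ i≤d))) (qpow-+ e g (d ∸ i)))

⊛-qpowˡ : ∀ e f g → (qpow e f ⊛ g) ≈ qpow e (f ⊛ g)
⊛-qpowˡ e f g = below-or-above _ e below above
  where
  open ≡-Reasoning
  below : ∀ m → m < e → (qpow e f ⊛ g) m ≡ qpow e (f ⊛ g) m
  below m m<e = begin
    (qpow e f ⊛ g) m                                   ≡⟨ conv (qpow e f) g m ⟩
    sumBelow (suc m) (λ i → qpow e f i * g (m ∸ i))    ≡⟨ sumBelow-zero (suc m) vanish ⟩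
    0                                                  ≡⟨ qpow-< e (f ⊛ g) m<e ⟨
    qpow e (f ⊛ g) m                                   ∎
    where
    vanish : ∀ i → i < suc m → qpow e f i * g (m ∸ i) ≡ 0
    vanish i i≤m = cong (_* g (m ∸ i)) (qpow-< e f (≤-<-trans (s≤s⁻¹ i≤m) m<e))
  above : ∀ d → (qpow e f ⊛ g) (e + d) ≡ qpow e (f ⊛ g) (e + d)
  above d = begin
    (qpow e f ⊛ g) (e + d)
      ≡⟨ conv (qpow e f) g (e + d) ⟩
    sumBelow (suc (e + d)) term
      ≡⟨ cong (λ n → sumBelow n term) (+-suc e d) ⟨
    sumBelow (e + suc d) term
      ≡⟨ sumBelow-split e (suc d) term ⟩
    sumBelow e term + sumBelow (suc d) (term ∘ (e +_))
      ≡⟨ cong₂ _+_ (sumBelow-zero e vanish) (sumBelow-cong (suc d) shifted) ⟩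
    sumBelow (suc d) (λ j → f j * g (d ∸ j))
      ≡⟨ conv f g d ⟨
    (f ⊛ g) d
      ≡⟨ qpow-+ e (f ⊛ g) d ⟨
    qpow e (f ⊛ g) (e + d) ∎
    where
    term : ℕ → ℕ
    term i = qpow e f i * g ((e + d) ∸ i)
    vanish : ∀ i → i < e → term i ≡ 0
    vanish i i<e = cong (_* g ((e + d) ∸ i)) (qpow-< e f i<e)
    shifted : ∀ j → j < suc d → term (e + j) ≡ f j * g (d ∸ j)
    shifted j _ = cong₂ _*_ (qpow-+ e f j) (cong g ([m+n]∸[m+o]≡n∸o e d j))

-- The coefficient of q^m in 1/(1 - q^e) = Σ_j q^{ej} counts the j with e j = m; hit e m j
-- records whether the term j contributes.
hit : ℕ → ℕ → ℕ → ℕ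
hit e m j = if e * j ≡ᵇ m then 1 else 0

length-filter-hit : ∀ e m js → length (filter (λ j → e * j ≟ m) js) ≡ sum (map (hit e m) js)
length-filter-hit e m [] = refl
length-filter-hit e m (j ∷ js) with e * j ≡ᵇ m
... | true = cong suc (length-filter-hit e m js)
... | false = length-filter-hit e m js

geom-sumBelow : ∀ e m → geom e m ≡ sumBelow (suc m) (hit e m)
geom-sumBelow e m = trans (length-filter-hit e m (upTo (suc m))) (sum-upTo (suc m) (hit e m))

hit-zero : ∀ e m → hit e m 0 ≡ one m
hit-zero e m rewrite *-zeroʳ e with m
... | zero = refl
... | suc _ = refl

hit-over : ∀ e m j → m < e * j → hit e m j ≡ 0
hit-over e m j m<ej with e * j ≡ᵇ m in eq
... | true = contradiction (≡ᵇ⇒≡ (e * j) m (subst T (sym eq) tt)) (>⇒≢ m<ej)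
... | false = refl

hit-suc : ∀ e d j → hit e (e + d) (suc j) ≡ hit e d j
hit-suc e d j rewrite *-suc e j = cong (λ b → if b then 1 else 0) (cancel e (e * j))
  where
  cancel : ∀ e x → (e + x ≡ᵇ e + d) ≡ (x ≡ᵇ d)
  cancel zero x = refl
  cancel (suc e) x = cancel e x

geom-unfold : ∀ e′ → geom (suc e′) ≈ (one ⊕ qpow (suc e′) (geom (suc e′)))
geom-unfold e′ m = trans (geom-sumBelow e m) (cong₂ _+_ (hit-zero e m) (positive m))
  where
  e = suc e′
  open ≡-Reasoning
  positive : ∀ m → sumBelow m (hit e m ∘ suc) ≡ qpow e (geom e) m
  positive = below-or-above _ e
    (λ m m<e → trans (sumBelow-zero m (λ j _ → hit-over e m (suc j) (<-≤-trans m<e (m≤m*n e (suc j)))))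
                     (sym (qpow-< e (geom e) m<e)))
    (λ d → begin
      sumBelow (e + d) (hit e (e + d) ∘ suc)   ≡⟨ sumBelow-cong (e + d) (λ j _ → hit-suc e d j) ⟩
      sumBelow (e + d) (hit e d)               ≡⟨ cong (λ n → sumBelow (suc n) (hit e d)) (+-comm e′ d) ⟩
      sumBelow (suc d + e′) (hit e d)          ≡⟨ sumBelow-trunc (suc d) e′ (hit e d) (λ j _ → hit-over e d (suc d + j)
                                                    (≤-trans (m≤m+n (suc d) j) (m≤n*m (suc d + j) e))) ⟩
      sumBelow (suc d) (hit e d)               ≡⟨ geom-sumBelow e d ⟨
      geom e d                                 ≡⟨ qpow-+ e (geom e) d ⟨
      qpow e (geom e) (e + d)                  ∎)

invPoch-suc : ∀ d′ n → invPoch (suc d′) (suc n) ≈ (invPoch (suc d′) n ⊕ qpow (suc d′ * suc n) (invPoch (suc d′) (suc n)))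
invPoch-suc d′ n m = begin
  (P ⊛ geom e) m                           ≡⟨ ⊛-cong {P} (λ _ → refl) (geom-unfold (n + d′ * suc n)) m ⟩
  (P ⊛ (one ⊕ qpow e (geom e))) m          ≡⟨ ⊛-distribˡ P one (qpow e (geom e)) m ⟩
  (P ⊛ one) m + (P ⊛ qpow e (geom e)) m    ≡⟨ cong₂ _+_ (⊛-identityʳ P m) (⊛-qpowʳ e P (geom e) m) ⟩
  P m + qpow e (P ⊛ geom e) m              ∎
  where
  open ≡-Reasoning
  P = invPoch (suc d′) n
  e = suc d′ * suc n

poch⁻¹ : ℕ → ℕ → Series
poch⁻¹ n₁ n₂ = invPoch 1 n₁ ⊛ invPoch 3 n₂

poch⁻¹-suc₁ : ∀ n₁ n₂ → poch⁻¹ (suc n₁) n₂ ≈ (poch⁻¹ n₁ n₂ ⊕ qpow (1 * suc n₁) (poch⁻¹ (suc n₁) n₂))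
poch⁻¹-suc₁ n₁ n₂ m = begin
  (P₁′ ⊛ P₃) m                             ≡⟨ ⊛-cong {g = P₃} (invPoch-suc 0 n₁) (λ _ → refl) m ⟩
  ((P₁ ⊕ qpow e P₁′) ⊛ P₃) m               ≡⟨ ⊛-distribʳ P₁ (qpow e P₁′) P₃ m ⟩
  (P₁ ⊛ P₃) m + (qpow e P₁′ ⊛ P₃) m        ≡⟨ cong ((P₁ ⊛ P₃) m +_) (⊛-qpowˡ e P₁′ P₃ m) ⟩
  (P₁ ⊛ P₃) m + qpow e (P₁′ ⊛ P₃) m        ∎
  where
  open ≡-Reasoning
  P₁ = invPoch 1 n₁
  P₁′ = invPoch 1 (suc n₁)
  P₃ = invPoch 3 n₂
  e = 1 * suc n₁

poch⁻¹-suc₂ : ∀ n₁ n₂ → poch⁻¹ n₁ (suc n₂) ≈ (poch⁻¹ n₁ n₂ ⊕ qpow (3 * suc n₂) (poch⁻¹ n₁ (suc n₂)))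
poch⁻¹-suc₂ n₁ n₂ m = begin
  (P₁ ⊛ P₃′) m                             ≡⟨ ⊛-cong {f = P₁} (λ _ → refl) (invPoch-suc 2 n₂) m ⟩
  (P₁ ⊛ (P₃ ⊕ qpow e P₃′)) m               ≡⟨ ⊛-distribˡ P₁ P₃ (qpow e P₃′) m ⟩
  (P₁ ⊛ P₃) m + (P₁ ⊛ qpow e P₃′) m        ≡⟨ cong ((P₁ ⊛ P₃) m +_) (⊛-qpowʳ e P₁ P₃′ m) ⟩
  (P₁ ⊛ P₃) m + qpow e (P₁ ⊛ P₃′) m        ∎
  where
  open ≡-Reasoning
  P₁ = invPoch 1 n₁
  P₃ = invPoch 3 n₂
  P₃′ = invPoch 3 (suc n₂)
  e = 3 * suc n₂

ex : ℕ → ℕ → ℕ → ℕ → ℕ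
ex a b n₁ n₂ = n₁ * n₁ + 3 * n₂ * n₂ + 3 * n₁ * n₂ + a * n₁ + b * n₂

-- the summand q^{ex a b n₁ n₂} / ((q;q)_{n₁} (q³;q³)_{n₂}) of R_{a,b}, read off at x^{n₁ + 2n₂}
term : ℕ → ℕ → ℕ → ℕ → Series
term a b n₁ n₂ = qpow (ex a b n₁ n₂) (poch⁻¹ n₁ n₂)

term-suc₁ : ∀ a b n₁ n₂ → term a b (suc n₁) n₂ ≈ (term (a + 1) b (suc n₁) n₂ ⊕ qpow (a + 1) (term (a + 2) (b + 3) n₁ n₂))
term-suc₁ a b n₁ n₂ m = begin
  qpow E P′ m
    ≡⟨ qpow-cong E (poch⁻¹-suc₁ n₁ n₂) m ⟩
  qpow E (P ⊕ qpow (1 * suc n₁) P′) m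
    ≡⟨ qpow-⊕ E P (qpow (1 * suc n₁) P′) m ⟩
  qpow E P m + qpow E (qpow (1 * suc n₁) P′) m
    ≡⟨ +-comm (qpow E P m) _ ⟩
  qpow E (qpow (1 * suc n₁) P′) m + qpow E P m
    ≡⟨ cong₂ _+_ (trans (qpow-qpow E (1 * suc n₁) P′ m) (qpow-exp P′ (grow a b n₁ n₂) m))
                 (trans (qpow-exp P (shift a b n₁ n₂) m) (sym (qpow-qpow (a + 1) (ex (a + 2) (b + 3) n₁ n₂) P m))) ⟩
  term (a + 1) b (suc n₁) n₂ m + qpow (a + 1) (term (a + 2) (b + 3) n₁ n₂) m ∎
  where
  open ≡-Reasoning
  E = ex a b (suc n₁) n₂
  P = poch⁻¹ n₁ n₂
  P′ = poch⁻¹ (suc n₁) n₂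
  grow : ∀ a b n₁ n₂ → (suc n₁ * suc n₁ + 3 * n₂ * n₂ + 3 * suc n₁ * n₂ + a * suc n₁ + b * n₂) + 1 * suc n₁
                     ≡ suc n₁ * suc n₁ + 3 * n₂ * n₂ + 3 * suc n₁ * n₂ + (a + 1) * suc n₁ + b * n₂
  grow = solve-∀
  shift : ∀ a b n₁ n₂ → suc n₁ * suc n₁ + 3 * n₂ * n₂ + 3 * suc n₁ * n₂ + a * suc n₁ + b * n₂
                      ≡ (a + 1) + (n₁ * n₁ + 3 * n₂ * n₂ + 3 * n₁ * n₂ + (a + 2) * n₁ + (b + 3) * n₂)
  shift = solve-∀

term-suc₂ : ∀ a b n₁ n₂ → term a b n₁ (suc n₂) ≈ (term a (b + 3) n₁ (suc n₂) ⊕ qpow (b + 3) (term (a + 3) (b + 6) n₁ n₂))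
term-suc₂ a b n₁ n₂ m = begin
  qpow E P′ m
    ≡⟨ qpow-cong E (poch⁻¹-suc₂ n₁ n₂) m ⟩
  qpow E (P ⊕ qpow (3 * suc n₂) P′) m
    ≡⟨ qpow-⊕ E P (qpow (3 * suc n₂) P′) m ⟩
  qpow E P m + qpow E (qpow (3 * suc n₂) P′) m
    ≡⟨ +-comm (qpow E P m) _ ⟩
  qpow E (qpow (3 * suc n₂) P′) m + qpow E P m
    ≡⟨ cong₂ _+_ (trans (qpow-qpow E (3 * suc n₂) P′ m) (qpow-exp P′ (grow a b n₁ n₂) m))
                 (trans (qpow-exp P (shift a b n₁ n₂) m) (sym (qpow-qpow (b + 3) (ex (a + 3) (b + 6) n₁ n₂) P m))) ⟩
  term a (b + 3) n₁ (suc n₂) m + qpow (b + 3) (term (a + 3) (b + 6) n₁ n₂) m ∎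
  where
  open ≡-Reasoning
  E = ex a b n₁ (suc n₂)
  P = poch⁻¹ n₁ n₂
  P′ = poch⁻¹ n₁ (suc n₂)
  grow : ∀ a b n₁ n₂ → (n₁ * n₁ + 3 * suc n₂ * suc n₂ + 3 * n₁ * suc n₂ + a * n₁ + b * suc n₂) + 3 * suc n₂
                     ≡ n₁ * n₁ + 3 * suc n₂ * suc n₂ + 3 * n₁ * suc n₂ + a * n₁ + (b + 3) * suc n₂
  grow = solve-∀
  shift : ∀ a b n₁ n₂ → n₁ * n₁ + 3 * suc n₂ * suc n₂ + 3 * n₁ * suc n₂ + a * n₁ + b * suc n₂
                      ≡ (b + 3) + (n₁ * n₁ + 3 * n₂ * n₂ + 3 * n₁ * n₂ + (a + 3) * n₁ + (b + 6) * n₂)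
  shift = solve-∀

term-zero₁ : ∀ a b n₂ → term a b 0 n₂ ≈ term (a + 1) b 0 n₂
term-zero₁ a b n₂ = qpow-exp (poch⁻¹ 0 n₂) (same a b n₂)
  where
  same : ∀ a b n₂ → 0 * 0 + 3 * n₂ * n₂ + 3 * 0 * n₂ + a * 0 + b * n₂ ≡ 0 * 0 + 3 * n₂ * n₂ + 3 * 0 * n₂ + (a + 1) * 0 + b * n₂
  same = solve-∀

term-zero₂ : ∀ a b n₁ → term a b n₁ 0 ≈ term a (b + 3) n₁ 0
term-zero₂ a b n₁ = qpow-exp (poch⁻¹ n₁ 0) (same a b n₁)
  where
  same : ∀ a b n₁ → n₁ * n₁ + 3 * 0 * 0 + 3 * n₁ * 0 + a * n₁ + b * 0 ≡ n₁ * n₁ + 3 * 0 * 0 + 3 * n₁ * 0 + a * n₁ + (b + 3) * 0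
  same = solve-∀

term-raise : ∀ a b n₁ n₂ → term (a + 3) (b + 6) n₁ n₂ ≈ qpow (3 * (n₁ + 2 * n₂)) (term a b n₁ n₂)
term-raise a b n₁ n₂ m =
  trans (qpow-exp (poch⁻¹ n₁ n₂) (shift a b n₁ n₂) m) (sym (qpow-qpow (3 * (n₁ + 2 * n₂)) (ex a b n₁ n₂) (poch⁻¹ n₁ n₂) m))
  where
  shift : ∀ a b n₁ n₂ → n₁ * n₁ + 3 * n₂ * n₂ + 3 * n₁ * n₂ + (a + 3) * n₁ + (b + 6) * n₂
                      ≡ 3 * (n₁ + 2 * n₂) + (n₁ * n₁ + 3 * n₂ * n₂ + 3 * n₁ * n₂ + a * n₁ + b * n₂)
  shift = solve-∀

term-empty : ∀ a b → term a b 0 0 ≈ one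
term-empty a b m = trans (qpow-exp (poch⁻¹ 0 0) (vanish a b) m) (⊛-identityʳ one m)
  where
  vanish : ∀ a b → 0 * 0 + 3 * 0 * 0 + 3 * 0 * 0 + a * 0 + b * 0 ≡ 0
  vanish = solve-∀

-- Σ_{n₁ + 2n₂ = N} g n₁ n₂, peeling off the term with n₂ = 0.
pairSum : (ℕ → ℕ → ℕ) → ℕ → ℕ
pairSum g 0 = g 0 0
pairSum g 1 = g 1 0
pairSum g (suc (suc N)) = g (suc (suc N)) 0 + pairSum (λ n₁ n₂ → g n₁ (suc n₂)) N

pairSum-cong : ∀ N {g g′ : ℕ → ℕ → ℕ} → (∀ n₁ n₂ → n₁ + 2 * n₂ ≡ N → g n₁ n₂ ≡ g′ n₁ n₂) →
               pairSum g N ≡ pairSum g′ N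
pairSum-cong 0 g≡g′ = g≡g′ 0 0 refl
pairSum-cong 1 g≡g′ = g≡g′ 1 0 refl
pairSum-cong (suc (suc N)) g≡g′ =
  cong₂ _+_ (g≡g′ (suc (suc N)) 0 (cong (suc ∘ suc) (+-identityʳ N)))
            (pairSum-cong N λ n₁ n₂ eq → g≡g′ n₁ (suc n₂) (trans (two-more n₁ n₂) (cong (suc ∘ suc) eq)))
  where
  two-more : ∀ n₁ n₂ → n₁ + 2 * suc n₂ ≡ suc (suc (n₁ + 2 * n₂))
  two-more = solve-∀

pairSum-+ : ∀ N (g h : ℕ → ℕ → ℕ) → pairSum (λ n₁ n₂ → g n₁ n₂ + h n₁ n₂) N ≡ pairSum g N + pairSum h N
pairSum-+ 0 g h = refl
pairSum-+ 1 g h = refl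
pairSum-+ (suc (suc N)) g h =
  trans (cong (g (suc (suc N)) 0 + h (suc (suc N)) 0 +_) (pairSum-+ N (λ n₁ n₂ → g n₁ (suc n₂)) (λ n₁ n₂ → h n₁ (suc n₂))))
        (interchange (g (suc (suc N)) 0) (h (suc (suc N)) 0) _ _)
  where
  interchange : ∀ a b c d → a + b + (c + d) ≡ a + c + (b + d)
  interchange = solve-∀

pairSum-zero : ∀ N → pairSum (λ _ _ → 0) N ≡ 0
pairSum-zero 0 = refl
pairSum-zero 1 = refl
pairSum-zero (suc (suc N)) = pairSum-zero N

shift₁ shift₂ : (ℕ → ℕ → ℕ) → ℕ → ℕ → ℕ
shift₁ g zero n₂ = 0
shift₁ g (suc n₁) n₂ = g n₁ n₂
shift₂ g n₁ zero = 0
shift₂ g n₁ (suc n₂) = g n₁ n₂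

pairSum-shift₁ : ∀ N g → pairSum (shift₁ g) (suc N) ≡ pairSum g N
pairSum-shift₁ 0 g = refl
pairSum-shift₁ 1 g = +-identityʳ (g 1 0)
pairSum-shift₁ (suc (suc N)) g =
  cong (g (suc (suc N)) 0 +_) (trans (pairSum-cong (suc N) λ { zero n₂ _ → refl ; (suc n₁) n₂ _ → refl })
                                     (pairSum-shift₁ N (λ n₁ n₂ → g n₁ (suc n₂))))

pairSum-shift₂ : ∀ N g → pairSum (shift₂ g) (suc (suc N)) ≡ pairSum g N
pairSum-shift₂ N g = refl

pairSum-qpow : ∀ N c (G : ℕ → ℕ → Series) M →
               pairSum (λ n₁ n₂ → qpow c (G n₁ n₂) M) N ≡ qpow c (λ M′ → pairSum (λ n₁ n₂ → G n₁ n₂ M′) N) M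
pairSum-qpow N c G = below-or-above _ c
  (λ M M<c → trans (pairSum-cong N (λ n₁ n₂ _ → qpow-< c (G n₁ n₂) M<c)) (trans (pairSum-zero N) (sym (qpow-< c total M<c))))
  (λ d → trans (pairSum-cong N (λ n₁ n₂ _ → qpow-+ c (G n₁ n₂) d)) (sym (qpow-+ c total d)))
  where
  total : Series
  total M′ = pairSum (λ n₁ n₂ → G n₁ n₂ M′) N

≤ᵇ-+ : ∀ k x y → (k + x ≤ᵇ k + y) ≡ (x ≤ᵇ y)
≤ᵇ-+ zero x y = refl
≤ᵇ-+ (suc k) x y = trans (≤ᵇ-suc (k + x) (k + y)) (≤ᵇ-+ k x y)
  where
  ≤ᵇ-suc : ∀ x y → (suc x ≤ᵇ suc y) ≡ (x ≤ᵇ y)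
  ≤ᵇ-suc zero y = refl
  ≤ᵇ-suc (suc x) y = refl

-- rhsCoeff sums over n₂ ≤ N the term of the pair (N - 2n₂, n₂) when it exists; this is pairSum.
onLine : (ℕ → ℕ → ℕ) → ℕ → ℕ → ℕ
onLine g N n₂ = if 2 * n₂ ≤ᵇ N then g (N ∸ 2 * n₂) n₂ else 0

onLine-beyond : ∀ g N n₂ → N < 2 * n₂ → onLine g N n₂ ≡ 0
onLine-beyond g N n₂ N<2n₂ with 2 * n₂ ≤ᵇ N in eq
... | true = contradiction (≤ᵇ⇒≤ (2 * n₂) N (subst T (sym eq) tt)) (<⇒≱ N<2n₂)
... | false = refl

onLine-suc : ∀ g N n₂ → onLine g (suc (suc N)) (suc n₂) ≡ onLine (λ n₁ n₂ → g n₁ (suc n₂)) N n₂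
onLine-suc g N n₂ = unfold (2 * suc n₂) (*-suc 2 n₂)
  where
  unfold : ∀ t → t ≡ 2 + 2 * n₂ →
           (if t ≤ᵇ suc (suc N) then g (suc (suc N) ∸ t) (suc n₂) else 0) ≡ onLine (λ n₁ n₂ → g n₁ (suc n₂)) N n₂
  unfold _ refl rewrite ≤ᵇ-+ 2 (2 * n₂) N = refl

1<2+2n : ∀ n → 1 < 2 * suc n
1<2+2n n = ≤-trans (s≤s (s≤s z≤n)) (≤-reflexive (sym (*-suc 2 n)))

sumBelow-onLine : ∀ N K g → N < 2 * K → sumBelow K (onLine g N) ≡ pairSum g N
sumBelow-onLine N zero g ()
sumBelow-onLine 0 (suc K) g _ = trans (cong (g 0 0 +_) (sumBelow-zero K λ n _ → onLine-beyond g 0 (suc n) (<-trans z<s (1<2+2n n)))) (+-identityʳ _)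
sumBelow-onLine 1 (suc K) g _ = trans (cong (g 1 0 +_) (sumBelow-zero K λ n _ → onLine-beyond g 1 (suc n) (1<2+2n n))) (+-identityʳ _)
sumBelow-onLine (suc (suc N)) (suc K) g N<2K =
  cong (g (suc (suc N)) 0 +_) (trans (sumBelow-cong K (λ n _ → onLine-suc g N n)) (sumBelow-onLine N K (λ n₁ n₂ → g n₁ (suc n₂)) N<2K′))
  where
  N<2K′ : N < 2 * K
  N<2K′ = s<s⁻¹ (s<s⁻¹ (subst (suc (suc N) <_) (*-suc 2 K) N<2K))

-- R a b N M: the coefficient of x^N q^M in Σ_{n₁,n₂} q^{ex a b n₁ n₂} x^{n₁+2n₂} / ((q;q)_{n₁} (q³;q³)_{n₂}).
R : ℕ → ℕ → ℕ → ℕ → ℕ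
R a b N M = pairSum (λ n₁ n₂ → term a b n₁ n₂ M) N

rhsCoeff-R : ∀ e a b → (∀ n₁ n₂ → e n₁ n₂ ≡ ex a b n₁ n₂) → ∀ N M → rhsCoeff e N M ≡ R a b N M
rhsCoeff-R e a b e≡ex N M = begin
  rhsCoeff e N M
    ≡⟨ sum-upTo (suc N) _ ⟩
  sumBelow (suc N) (onLine (λ n₁ n₂ → qpow (e n₁ n₂) (poch⁻¹ n₁ n₂) M) N)
      ≡⟨ sumBelow-onLine N (suc N) _ (≤-trans (n<1+n N) (m≤n*m (suc N) 2)) ⟩
  pairSum (λ n₁ n₂ → qpow (e n₁ n₂) (poch⁻¹ n₁ n₂) M) N
    ≡⟨ pairSum-cong N (λ n₁ n₂ _ → qpow-exp (poch⁻¹ n₁ n₂) (e≡ex n₁ n₂) M) ⟩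
  R a b N M ∎
  where open ≡-Reasoning

-- Series in x and q as coefficient families ℕ → ℕ → ℕ (coefficient of x^N q^M): pointwise sum,
-- and multiplication by x^dN q^dM.
_+ᶜ_ : (ℕ → ℕ → ℕ) → (ℕ → ℕ → ℕ) → ℕ → ℕ → ℕ
(f +ᶜ g) N M = f N M + g N M

xq : ℕ → ℕ → (ℕ → ℕ → ℕ) → ℕ → ℕ → ℕ
xq (suc dN) dM f zero M = 0
xq (suc dN) dM f (suc N) M = xq dN dM f N M
xq zero (suc dM) f N zero = 0
xq zero (suc dM) f N (suc M) = xq zero dM f N M
xq zero zero f N M = f N M

qpow-xq : ∀ c f N M → qpow c (f N) M ≡ xq 0 c f N M
qpow-xq zero f N M = refl
qpow-xq (suc c) f N zero = refl
qpow-xq (suc c) f N (suc M) = trans (sym (qpow-qpow 1 c (f N) (suc M))) (trans (qpow-+ 1 (qpow c (f N)) M) (qpow-xq c f N M))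

xq-+ᶜ : ∀ dN dM f g N M → xq dN dM (f +ᶜ g) N M ≡ xq dN dM f N M + xq dN dM g N M
xq-+ᶜ (suc dN) dM f g zero M = refl
xq-+ᶜ (suc dN) dM f g (suc N) M = xq-+ᶜ dN dM f g N M
xq-+ᶜ zero (suc dM) f g N zero = refl
xq-+ᶜ zero (suc dM) f g N (suc M) = xq-+ᶜ zero dM f g N M
xq-+ᶜ zero zero f g N M = refl

xq-zero : ∀ dN dM f N → xq dN (suc dM) f N 0 ≡ 0
xq-zero (suc dN) dM f zero = refl
xq-zero (suc dN) dM f (suc N) = xq-zero dN dM f N
xq-zero zero dM f N = refl

xq-suc : ∀ dN dM f N M → xq dN dM f N M ≡ xq dN (suc dM) f N (suc M)
xq-suc (suc dN) dM f zero M = refl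
xq-suc (suc dN) dM f (suc N) M = xq-suc dN dM f N M
xq-suc zero dM f N M = refl

xq-xq : ∀ dN dM dN′ dM′ f N M → xq dN dM (xq dN′ dM′ f) N M ≡ xq (dN + dN′) (dM + dM′) f N M
xq-xq (suc dN) dM dN′ dM′ f zero M = refl
xq-xq (suc dN) dM dN′ dM′ f (suc N) M = xq-xq dN dM dN′ dM′ f N M
xq-xq zero (suc dM) dN′ dM′ f N zero = sym (xq-zero dN′ (dM + dM′) f N)
xq-xq zero (suc dM) dN′ dM′ f N (suc M) = trans (xq-xq zero dM dN′ dM′ f N M) (xq-suc dN′ (dM + dM′) f N M)
xq-xq zero zero dN′ dM′ f N M = refl

xq-cong : ∀ dN dM {f g : ℕ → ℕ → ℕ} → (∀ N M → f N M ≡ g N M) → ∀ N M → xq dN dM f N M ≡ xq dN dM g N M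
xq-cong (suc dN) dM f≡g zero M = refl
xq-cong (suc dN) dM f≡g (suc N) M = xq-cong dN dM f≡g N M
xq-cong zero (suc dM) f≡g N zero = refl
xq-cong zero (suc dM) f≡g N (suc M) = xq-cong zero dM f≡g N M
xq-cong zero zero f≡g N M = f≡g N M

R-suc-a : ∀ a b N M → R a b N M ≡ R (a + 1) b N M + xq 1 (a + 1) (R (a + 2) (b + 3)) N M
R-suc-a a b N M = begin
  R a b N M
    ≡⟨ pairSum-cong N (λ { zero n₂ _ → trans (term-zero₁ a b n₂ M) (sym (+-identityʳ _)) ; (suc n₁) n₂ _ → term-suc₁ a b n₁ n₂ M }) ⟩
  pairSum (λ n₁ n₂ → term (a + 1) b n₁ n₂ M + shift₁ (λ n₁ n₂ → qpow (a + 1) (term (a + 2) (b + 3) n₁ n₂) M) n₁ n₂) N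
    ≡⟨ pairSum-+ N _ _ ⟩
  R (a + 1) b N M + pairSum (shift₁ (λ n₁ n₂ → qpow (a + 1) (term (a + 2) (b + 3) n₁ n₂) M)) N
    ≡⟨ cong (R (a + 1) b N M +_) (shifted N) ⟩
  R (a + 1) b N M + xq 1 (a + 1) (R (a + 2) (b + 3)) N M ∎
  where
  open ≡-Reasoning
  shifted : ∀ N → pairSum (shift₁ (λ n₁ n₂ → qpow (a + 1) (term (a + 2) (b + 3) n₁ n₂) M)) N ≡ xq 1 (a + 1) (R (a + 2) (b + 3)) N M
  shifted zero = refl
  shifted (suc N) = trans (pairSum-shift₁ N _) (trans (pairSum-qpow N (a + 1) (term (a + 2) (b + 3)) M) (qpow-xq (a + 1) (R (a + 2) (b + 3)) N M))

R-suc-b : ∀ a b N M → R a b N M ≡ R a (b + 3) N M + xq 2 (b + 3) (R (a + 3) (b + 6)) N M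
R-suc-b a b N M = begin
  R a b N M
    ≡⟨ pairSum-cong N (λ { n₁ zero _ → trans (term-zero₂ a b n₁ M) (sym (+-identityʳ _)) ; n₁ (suc n₂) _ → term-suc₂ a b n₁ n₂ M }) ⟩
  pairSum (λ n₁ n₂ → term a (b + 3) n₁ n₂ M + shift₂ (λ n₁ n₂ → qpow (b + 3) (term (a + 3) (b + 6) n₁ n₂) M) n₁ n₂) N
    ≡⟨ pairSum-+ N _ _ ⟩
  R a (b + 3) N M + pairSum (shift₂ (λ n₁ n₂ → qpow (b + 3) (term (a + 3) (b + 6) n₁ n₂) M)) N
    ≡⟨ cong (R a (b + 3) N M +_) (shifted N) ⟩
  R a (b + 3) N M + xq 2 (b + 3) (R (a + 3) (b + 6)) N M ∎
  where
  open ≡-Reasoning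
  shifted : ∀ N → pairSum (shift₂ (λ n₁ n₂ → qpow (b + 3) (term (a + 3) (b + 6) n₁ n₂) M)) N ≡ xq 2 (b + 3) (R (a + 3) (b + 6)) N M
  shifted zero = refl
  shifted (suc zero) = refl
  shifted (suc (suc N)) = trans (pairSum-shift₂ N _) (trans (pairSum-qpow N (b + 3) (term (a + 3) (b + 6)) M) (qpow-xq (b + 3) (R (a + 3) (b + 6)) N M))

-- R_{a+3,b+6}(x, q) = R_{a,b}(x q³, q)
R-raise : ∀ a b N M → R (a + 3) (b + 6) N M ≡ xq 0 (3 * N) (R a b) N M
R-raise a b N M = begin
  R (a + 3) (b + 6) N M
    ≡⟨ pairSum-cong N (λ n₁ n₂ on-line → trans (term-raise a b n₁ n₂ M) (cong (λ n → qpow (3 * n) (term a b n₁ n₂) M) on-line)) ⟩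
  pairSum (λ n₁ n₂ → qpow (3 * N) (term a b n₁ n₂) M) N
    ≡⟨ pairSum-qpow N (3 * N) (term a b) M ⟩
  qpow (3 * N) (R a b N) M
    ≡⟨ qpow-xq (3 * N) (R a b) N M ⟩
  xq 0 (3 * N) (R a b) N M ∎
  where open ≡-Reasoning

R-empty : ∀ a b M → R a b 0 M ≡ one M
R-empty a b M = term-empty a b M

R₁ R₂ R₃ R₄ R₅ R₆ : ℕ → ℕ → ℕ
R₁ = R 0 0
R₂ = R 1 3
R₃ = R 2 3
R₄ = R 3 6
R₅ = R 4 9
R₆ = R 5 9

R₂-split : ∀ N M → R₂ N M ≡ R₃ N M + xq 1 2 R₄ N M
R₂-split = R-suc-a 1 3

R₃-split : ∀ N M → R₃ N M ≡ R₄ N M + xq 1 3 (R₅ +ᶜ xq 1 3 R₆) N M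
R₃-split N M = begin
  R₃ N M
    ≡⟨ R-suc-b 2 3 N M ⟩
  R 2 6 N M + xq 2 6 R₆ N M
    ≡⟨ cong (_+ xq 2 6 R₆ N M) (R-suc-a 2 6 N M) ⟩
  (R₄ N M + xq 1 3 R₅ N M) + xq 2 6 R₆ N M
    ≡⟨ +-assoc (R₄ N M) _ _ ⟩
  R₄ N M + (xq 1 3 R₅ N M + xq 2 6 R₆ N M)
    ≡⟨ cong (R₄ N M +_) (cong (xq 1 3 R₅ N M +_) (xq-xq 1 3 1 3 R₆ N M)) ⟨
  R₄ N M + (xq 1 3 R₅ N M + xq 1 3 (xq 1 3 R₆) N M)
    ≡⟨ cong (R₄ N M +_) (xq-+ᶜ 1 3 R₅ (xq 1 3 R₆) N M) ⟨
  R₄ N M + xq 1 3 (R₅ +ᶜ xq 1 3 R₆) N M ∎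
  where open ≡-Reasoning

R₁-split : ∀ N M → R₁ N M ≡ R₂ N M + xq 1 1 ((R₄ +ᶜ xq 1 3 R₅) +ᶜ xq 1 2 R₄) N M
R₁-split N M = begin
  R₁ N M                                                   ≡⟨ R-suc-a 0 0 N M ⟩
  R 1 0 N M + xq 1 1 R₃ N M                                ≡⟨ cong₂ _+_ (R-suc-b 1 0 N M) xq-R₃ ⟩
  (R₂ N M + r₄₆) + (xq 1 1 R₄ N M + (xq 2 4 R₅ N M + r₆))  ≡⟨ regroup (R₂ N M) r₄₆ (xq 1 1 R₄ N M) (xq 2 4 R₅ N M) r₆ ⟩
  R₂ N M + ((xq 1 1 R₄ N M + xq 2 4 R₅ N M) + (r₄₆ + r₆))  ≡⟨ cong (R₂ N M +_) xq-tail₁ ⟨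
  R₂ N M + xq 1 1 ((R₄ +ᶜ xq 1 3 R₅) +ᶜ xq 1 2 R₄) N M     ∎
  where
  open ≡-Reasoning
  r₄₆ = xq 2 3 (R 4 6) N M
  r₆ = xq 3 7 R₆ N M
  regroup : ∀ a b c d e → (a + b) + (c + (d + e)) ≡ a + ((c + d) + (b + e))
  regroup = solve-∀
  xq-R₃ : xq 1 1 R₃ N M ≡ xq 1 1 R₄ N M + (xq 2 4 R₅ N M + r₆)
  xq-R₃ = begin
    xq 1 1 R₃ N M
      ≡⟨ xq-cong 1 1 R₃-split N M ⟩
    xq 1 1 (R₄ +ᶜ xq 1 3 (R₅ +ᶜ xq 1 3 R₆)) N M
      ≡⟨ xq-+ᶜ 1 1 R₄ _ N M ⟩
    xq 1 1 R₄ N M + xq 1 1 (xq 1 3 (R₅ +ᶜ xq 1 3 R₆)) N M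
      ≡⟨ cong (xq 1 1 R₄ N M +_) (xq-xq 1 1 1 3 _ N M) ⟩
    xq 1 1 R₄ N M + xq 2 4 (R₅ +ᶜ xq 1 3 R₆) N M
      ≡⟨ cong (xq 1 1 R₄ N M +_) (xq-+ᶜ 2 4 R₅ _ N M) ⟩
    xq 1 1 R₄ N M + (xq 2 4 R₅ N M + xq 2 4 (xq 1 3 R₆) N M) ≡⟨ cong (λ z → xq 1 1 R₄ N M + (xq 2 4 R₅ N M + z)) (xq-xq 2 4 1 3 R₆ N M) ⟩
    xq 1 1 R₄ N M + (xq 2 4 R₅ N M + r₆) ∎
  xq-tail₁ : xq 1 1 ((R₄ +ᶜ xq 1 3 R₅) +ᶜ xq 1 2 R₄) N M ≡ (xq 1 1 R₄ N M + xq 2 4 R₅ N M) + (r₄₆ + r₆)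
  xq-tail₁ = begin
    xq 1 1 ((R₄ +ᶜ xq 1 3 R₅) +ᶜ xq 1 2 R₄) N M
      ≡⟨ xq-+ᶜ 1 1 (R₄ +ᶜ xq 1 3 R₅) _ N M ⟩
    xq 1 1 (R₄ +ᶜ xq 1 3 R₅) N M + xq 1 1 (xq 1 2 R₄) N M
      ≡⟨ cong₂ _+_ (xq-+ᶜ 1 1 R₄ _ N M) (xq-xq 1 1 1 2 R₄ N M) ⟩
    (xq 1 1 R₄ N M + xq 1 1 (xq 1 3 R₅) N M) + xq 2 3 R₄ N M
      ≡⟨ cong₂ (λ y z → (xq 1 1 R₄ N M + y) + z) (xq-xq 1 1 1 3 R₅ N M) (xq-cong 2 3 (R-suc-a 3 6) N M) ⟩
    (xq 1 1 R₄ N M + xq 2 4 R₅ N M) + xq 2 3 (R 4 6 +ᶜ xq 1 4 R₆) N M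
      ≡⟨ cong (xq 1 1 R₄ N M + xq 2 4 R₅ N M +_) (xq-+ᶜ 2 3 (R 4 6) _ N M) ⟩
    (xq 1 1 R₄ N M + xq 2 4 R₅ N M) + (r₄₆ + xq 2 3 (xq 1 4 R₆) N M)
      ≡⟨ cong (λ z → (xq 1 1 R₄ N M + xq 2 4 R₅ N M) + (r₄₆ + z)) (xq-xq 2 3 1 4 R₆ N M) ⟩
    (xq 1 1 R₄ N M + xq 2 4 R₅ N M) + (r₄₆ + r₆) ∎


∧-intro : ∀ {x y} → T x → T y → T (x ∧ y)
∧-intro {true} _ t = t

∧-fst : ∀ {x y} → T (x ∧ y) → T x
∧-fst {true} _ = tt

∧-snd : ∀ {x y} → T (x ∧ y) → T y
∧-snd {true} t = t

Sized : (List ℕ → Bool) → ℕ → ℕ → Set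
Sized P N M = Σ (List ℕ) λ ps → T (P ps) × length ps ≡ N × sum ps ≡ M

Sized-≡ : ∀ {P N M} (x y : Sized P N M) → proj₁ x ≡ proj₁ y → x ≡ y
Sized-≡ (ps , p , l , s) (.ps , p′ , l′ , s′) refl
  rewrite T-irrelevant p p′ | ≡-irrelevant l l′ | ≡-irrelevant s s′ = refl

Sized-equiv : ∀ {P Q N M} → (∀ ps → T (P ps) ⇔ T (Q ps)) → Sized P N M ↔ Sized Q N M
Sized-equiv P⇔Q = mk↔ₛ′ (λ (ps , p , ls) → ps , Equivalence.to (P⇔Q ps) p , ls) (λ (ps , q , ls) → ps , Equivalence.from (P⇔Q ps) q , ls)
                        (λ _ → Sized-≡ _ _ refl) (λ _ → Sized-≡ _ _ refl)

-- The combinatorial counterpart of multiplication by x^dN q^dM.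
XQ : ℕ → ℕ → (ℕ → ℕ → Set) → ℕ → ℕ → Set
XQ dN dM F N M = Σ ℕ λ N′ → Σ ℕ λ M′ → dN + N′ ≡ N × dM + M′ ≡ M × F N′ M′

XQ-Sized-≡ : ∀ {dN dM P N M N₁ M₁ N₂ M₂} {e₁ : dN + N₁ ≡ N} {e₂ : dM + M₁ ≡ M} {e₁′ : dN + N₂ ≡ N} {e₂′ : dM + M₂ ≡ M}
             (x : Sized P N₁ M₁) (y : Sized P N₂ M₂) → proj₁ x ≡ proj₁ y →
             _≡_ {A = XQ dN dM (Sized P) N M} (N₁ , M₁ , e₁ , e₂ , x) (N₂ , M₂ , e₁′ , e₂′ , y)
XQ-Sized-≡ {e₁ = e₁} {e₂} {e₁′} {e₂′} (ps , p , refl , refl) (.ps , p′ , refl , refl) refl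
  rewrite T-irrelevant p p′ | ≡-irrelevant e₁ e₁′ | ≡-irrelevant e₂ e₂′ = refl

XQ-cong : ∀ {dN dM} {F G : ℕ → ℕ → Set} → (∀ N M → F N M ↔ G N M) → ∀ {N M} → XQ dN dM F N M ↔ XQ dN dM G N M
XQ-cong F↔G = mk↔ₛ′ (λ (N′ , M′ , e₁ , e₂ , x) → N′ , M′ , e₁ , e₂ , to (F↔G N′ M′) x)
                     (λ (N′ , M′ , e₁ , e₂ , y) → N′ , M′ , e₁ , e₂ , from (F↔G N′ M′) y)
                     (λ (N′ , M′ , e₁ , e₂ , y) → cong (λ y → N′ , M′ , e₁ , e₂ , y) (strictlyInverseˡ (F↔G N′ M′) y))
                     (λ (N′ , M′ , e₁ , e₂ , x) → cong (λ x → N′ , M′ , e₁ , e₂ , x) (strictlyInverseʳ (F↔G N′ M′) x))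
  where open Inverse

XQ-suc₁ : ∀ dN dM F N M → XQ dN dM F N M ↔ XQ (suc dN) dM F (suc N) M
XQ-suc₁ dN dM F N M = mk↔ₛ′ (λ (N′ , M′ , e₁ , e₂ , x) → N′ , M′ , cong suc e₁ , e₂ , x)
                            (λ (N′ , M′ , e₁ , e₂ , x) → N′ , M′ , suc-injective e₁ , e₂ , x)
                            (λ (N′ , M′ , e₁ , e₂ , x) → cong (λ e → N′ , M′ , e , e₂ , x) (≡-irrelevant _ _))
                            (λ (N′ , M′ , e₁ , e₂ , x) → cong (λ e → N′ , M′ , e , e₂ , x) (≡-irrelevant _ _))

XQ-suc₂ : ∀ dM F N M → XQ 0 dM F N M ↔ XQ 0 (suc dM) F N (suc M)
XQ-suc₂ dM F N M = mk↔ₛ′ (λ (N′ , M′ , e₁ , e₂ , x) → N′ , M′ , e₁ , cong suc e₂ , x)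
                         (λ (N′ , M′ , e₁ , e₂ , x) → N′ , M′ , e₁ , suc-injective e₂ , x)
                         (λ (N′ , M′ , e₁ , e₂ , x) → cong (λ e → N′ , M′ , e₁ , e , x) (≡-irrelevant _ _))
                         (λ (N′ , M′ , e₁ , e₂ , x) → cong (λ e → N′ , M′ , e₁ , e , x) (≡-irrelevant _ _))

XQ-zero : ∀ F N M → F N M ↔ XQ 0 0 F N M
XQ-zero F N M = mk↔ₛ′ (λ x → N , M , refl , refl , x) (λ { (_ , _ , refl , refl , x) → x })
                      (λ { (_ , _ , refl , refl , x) → refl }) (λ _ → refl)

XQ-empty₁ : ∀ dN dM F M → Fin 0 ↔ XQ (suc dN) dM F 0 M
XQ-empty₁ dN dM F M = mk↔ₛ′ (λ ()) (λ { (_ , _ , () , _) }) (λ { (_ , _ , () , _) }) (λ ())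

XQ-empty₂ : ∀ dM F N → Fin 0 ↔ XQ 0 (suc dM) F N 0
XQ-empty₂ dM F N = mk↔ₛ′ (λ ()) (λ { (_ , _ , _ , () , _) }) (λ { (_ , _ , _ , () , _) }) (λ ())

headNot : ℕ → List ℕ → Bool
headNot v [] = true
headNot v (a ∷ _) = not (a ≡ᵇ v)

headNot-≢ : ∀ {a v} → a ≢ v → T (not (a ≡ᵇ v))
headNot-≢ {a} {v} a≢v with a ≡ᵇ v in eq
... | true = a≢v (≡ᵇ⇒≡ a v (subst T (sym eq) tt))
... | false = tt

headNot⇒≢ : ∀ {a v} → T (not (a ≡ᵇ v)) → a ≢ v
headNot⇒≢ {a} t refl = contradict t (≡⇒≡ᵇ a a refl)
  where
  contradict : ∀ {b} → T (not b) → T b → ⊥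
  contradict {false} _ ()

Sized-split : ∀ v {P N M} → Sized P N M ↔ (Sized (λ ps → P ps ∧ headNot v ps) N M ⊎ XQ 1 v (Sized (P ∘ (v ∷_))) N M)
Sized-split v {P} {N} {M} = mk↔ₛ′ to from to∘from from∘to
  where
  to : Sized P N M → Sized (λ ps → P ps ∧ headNot v ps) N M ⊎ XQ 1 v (Sized (P ∘ (v ∷_))) N M
  to ([] , p , ls) = inj₁ ([] , ∧-intro p tt , ls)
  to ((a ∷ r) , p , ls@(l , s)) with a ≟ v
  ... | yes refl = inj₂ (length r , sum r , l , s , r , p , refl , refl)
  ... | no a≢v = inj₁ ((a ∷ r) , ∧-intro p (headNot-≢ a≢v) , ls)
  from : Sized (λ ps → P ps ∧ headNot v ps) N M ⊎ XQ 1 v (Sized (P ∘ (v ∷_))) N M → Sized P N M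
  from (inj₁ (ps , p , ls)) = ps , ∧-fst p , ls
  from (inj₂ (_ , _ , e₁ , e₂ , r , p , refl , refl)) = (v ∷ r) , p , e₁ , e₂
  to∘from : ∀ y → to (from y) ≡ y
  to∘from (inj₁ ([] , p , ls)) = cong inj₁ (Sized-≡ _ _ refl)
  to∘from (inj₁ ((a ∷ r) , p , ls)) with a ≟ v
  ... | yes refl = ⊥-elim (headNot⇒≢ {a} (∧-snd {P (a ∷ r)} p) refl)
  ... | no _ = cong inj₁ (Sized-≡ _ _ refl)
  to∘from (inj₂ (_ , _ , e₁ , e₂ , r , p , refl , refl)) with v ≟ v
  ... | yes refl = refl
  ... | no v≢v = ⊥-elim (v≢v refl)
  from∘to : ∀ x → from (to x) ≡ x
  from∘to ([] , p , ls) = Sized-≡ _ _ refl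
  from∘to ((a ∷ r) , p , ls) with a ≟ v
  ... | yes refl = refl
  ... | no _ = Sized-≡ _ _ refl

linksOK : (ℕ → ℕ → Bool) → (ℕ → ℕ → Bool) → ℕ → List ℕ → Bool
linksOK p t a [] = true
linksOK p t a (b ∷ []) = p a b
linksOK p t a (b ∷ c ∷ _) = p a b ∧ t a c

window : (ℕ → ℕ → Bool) → (ℕ → ℕ → Bool) → List ℕ → Bool
window p t [] = true
window p t (a ∷ r) = linksOK p t a r ∧ window p t r

linksInto : (ℕ → ℕ → Bool) → (ℕ → ℕ → Bool) → List ℕ → ℕ → Bool
linksInto p t [] z = true
linksInto p t (y ∷ []) z = p y z
linksInto p t (x ∷ y ∷ []) z = p y z ∧ t x z
linksInto p t (x ∷ y ∷ w ∷ r) z = linksInto p t (y ∷ w ∷ r) z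

window-snoc : ∀ p t xs z → window p t (xs ++ z ∷ []) ≡ window p t xs ∧ linksInto p t xs z
window-snoc p t [] z = refl
window-snoc p t (a ∷ []) z = ∧-identityʳ (p a z)
window-snoc p t (a ∷ b ∷ []) z = shuffle (p a b) (t a z) (p b z)
  where
  shuffle : ∀ x y w → (x ∧ y) ∧ (w ∧ true) ≡ (x ∧ true) ∧ (w ∧ y)
  shuffle true true w = refl
  shuffle true false w = sym (∧-zeroʳ w)
  shuffle false y w = refl
window-snoc p t (a ∷ b ∷ c ∷ r) z = begin
  linksOK p t a (b ∷ c ∷ r) ∧ window p t (b ∷ c ∷ r ++ z ∷ [])
    ≡⟨ cong (linksOK p t a (b ∷ c ∷ r) ∧_) (window-snoc p t (b ∷ c ∷ r) z) ⟩
  linksOK p t a (b ∷ c ∷ r) ∧ (window p t (b ∷ c ∷ r) ∧ linksInto p t (b ∷ c ∷ r) z)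
    ≡⟨ sym (∧-assoc (linksOK p t a (b ∷ c ∷ r)) _ _) ⟩
  (linksOK p t a (b ∷ c ∷ r) ∧ window p t (b ∷ c ∷ r)) ∧ linksInto p t (b ∷ c ∷ r) z ∎
  where open ≡-Reasoning

linksInto-end : ∀ p t xs y x z → linksInto p t (xs ++ x ∷ y ∷ []) z ≡ p y z ∧ t x z
linksInto-end p t [] y x z = refl
linksInto-end p t (w ∷ []) y x z = refl
linksInto-end p t (w ∷ w′ ∷ []) y x z = linksInto-end p t (w′ ∷ []) y x z
linksInto-end p t (w ∷ w′ ∷ w″ ∷ ws) y x z = linksInto-end p t (w′ ∷ w″ ∷ ws) y x z

linksInto-reverse : ∀ p t a r → linksInto p t (reverse r) a ≡ linksOK (flip p) (flip t) a r
linksInto-reverse p t a [] = refl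
linksInto-reverse p t a (b ∷ []) = refl
linksInto-reverse p t a (b ∷ c ∷ r) =
  trans (cong (λ xs → linksInto p t xs a) (reverse-++ (b ∷ c ∷ []) r)) (linksInto-end p t (reverse r) b c a)

window-reverse : ∀ p t xs → window p t (reverse xs) ≡ window (flip p) (flip t) xs
window-reverse p t [] = refl
window-reverse p t (a ∷ r) = begin
  window p t (reverse (a ∷ r))
    ≡⟨ cong (window p t) (unfold-reverse a r) ⟩
  window p t (reverse r ++ a ∷ [])
    ≡⟨ window-snoc p t (reverse r) a ⟩
  window p t (reverse r) ∧ linksInto p t (reverse r) a
    ≡⟨ cong₂ _∧_ (window-reverse p t r) (linksInto-reverse p t a r) ⟩
  window (flip p) (flip t) r ∧ linksOK (flip p) (flip t) a r ≡⟨ ∧-comm (window (flip p) (flip t) r) _ ⟩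
  linksOK (flip p) (flip t) a r ∧ window (flip p) (flip t) r ∎
  where open ≡-Reasoning

-- Condition (ii) and the order for consecutive parts a ≤ b, and condition (i)
-- for parts a ≤ c two places apart, read in increasing order.
adjacentOK : ℕ → ℕ → Bool
adjacentOK a b = pairOK b a

gapOK : ℕ → ℕ → Bool
gapOK a c = a + 3 ≤ᵇ c

-- T_I-conditions for a list read smallest part first, resp. largest part first.
ascending : List ℕ → Bool
ascending = window adjacentOK gapOK

descending : List ℕ → Bool
descending = window pairOK (flip gapOK)

headAtLeast : ℕ → List ℕ → Bool
headAtLeast k [] = true
headAtLeast k (a ∷ _) = k ≤ᵇ a

asc : ℕ → List ℕ → Bool
asc k ps = ascending ps ∧ headAtLeast k ps

Ptn : ℕ → ℕ → ℕ → Set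
Ptn k = Sized (asc k)

linksUp : ℕ → List ℕ → Bool
linksUp = linksOK adjacentOK gapOK

asc-∷⁻ : ∀ k a r → T (asc k (a ∷ r)) → k ≤ a × T (linksUp a r) × T (ascending r)
asc-∷⁻ k a r t = ≤ᵇ⇒≤ k a (∧-snd t) , ∧-fst (∧-fst t) , ∧-snd {linksUp a r} (∧-fst t)

asc-∷⁺ : ∀ k a r → k ≤ a → T (linksUp a r) → T (ascending r) → T (asc k (a ∷ r))
asc-∷⁺ k a r k≤a l t = ∧-intro (∧-intro l t) (≤⇒≤ᵇ k≤a)

pairOK-≤ : ∀ a b → T (pairOK b a) → a ≤ b
pairOK-≤ a b t = ≤ᵇ⇒≤ a b (∧-fst t)

pairOK-far : ∀ a b → a + 2 ≤ b → T (pairOK b a)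
pairOK-far a b a+2≤b with b ≤ᵇ a + 1 in eq
... | true = contradiction (≤ᵇ⇒≤ b (a + 1) (subst T (sym eq) tt)) (<⇒≱ (≤-trans (≤-reflexive (sym (+-suc a 1))) a+2≤b))
... | false = ∧-intro (≤⇒≤ᵇ (≤-trans (m≤m+n a 2) a+2≤b)) tt

linksUp-first : ∀ a b r → T (linksUp a (b ∷ r)) → T (pairOK b a)
linksUp-first a b [] t = t
linksUp-first a b (c ∷ r) t = ∧-fst t

ascending-sorted : ∀ a r → T (ascending (a ∷ r)) → All (a ≤_) r
ascending-sorted a [] t = []
ascending-sorted a (b ∷ r) t = a≤b ∷ All.map (≤-trans a≤b) (ascending-sorted b r (∧-snd {linksUp a (b ∷ r)} t))
  where a≤b = pairOK-≤ a b (linksUp-first a b r (∧-fst t))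

asc⇒All : ∀ k ps → T (asc k ps) → All (k ≤_) ps
asc⇒All k [] t = []
asc⇒All k (a ∷ r) t with asc-∷⁻ k a r t
... | k≤a , _ , _ = k≤a ∷ All.map (≤-trans k≤a) (ascending-sorted a r (∧-fst t))

ascending-reverse : ∀ ps → ascending (reverse ps) ≡ descending ps
ascending-reverse = window-reverse adjacentOK gapOK

descending-reverse : ∀ ps → descending (reverse ps) ≡ ascending ps
descending-reverse = window-reverse pairOK (flip gapOK)

inPT⇒descending : ∀ ps → T (inPT ps) → T (descending ps)
inPT⇒descending [] t = tt
inPT⇒descending (a ∷ []) t = tt
inPT⇒descending (a ∷ b ∷ []) t = ∧-intro {pairOK a b} (∧-fst {pairOK a b} t) tt
inPT⇒descending (a ∷ b ∷ c ∷ r) t =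
  ∧-intro {pairOK a b ∧ (c + 3 ≤ᵇ a)} (∧-intro {pairOK a b} (∧-fst {pairOK a b} t) (∧-fst {c + 3 ≤ᵇ a} rest))
    (inPT⇒descending (b ∷ c ∷ r) (∧-snd {c + 3 ≤ᵇ a} rest))
  where rest = ∧-snd {pairOK a b} t

-- (positivity is only checked on the last part by inPT)
descending⇒inPT : ∀ ps → All (1 ≤_) ps → T (descending ps) → T (inPT ps)
descending⇒inPT [] _ t = tt
descending⇒inPT (a ∷ []) (1≤a ∷ []) t = ≤⇒≤ᵇ 1≤a
descending⇒inPT (a ∷ b ∷ []) (_ ∷ 1≤b ∷ []) t = ∧-intro {pairOK a b} (∧-fst {pairOK a b} t) (≤⇒≤ᵇ 1≤b)
descending⇒inPT (a ∷ b ∷ c ∷ r) (_ ∷ pos) t =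
  ∧-intro {pairOK a b} (∧-fst {pairOK a b} links)
    (∧-intro {c + 3 ≤ᵇ a} (∧-snd {pairOK a b} links) (descending⇒inPT (b ∷ c ∷ r) pos (∧-snd {pairOK a b ∧ (c + 3 ≤ᵇ a)} t)))
  where links = ∧-fst {pairOK a b ∧ (c + 3 ≤ᵇ a)} t

All-reverse : ∀ {P : ℕ → Set} xs → All P xs → All P (reverse xs)
All-reverse xs = All-resp-↭ (↭-sym (↭-reverse xs))

All⇒headAtLeast : ∀ k ps → All (k ≤_) ps → T (headAtLeast k ps)
All⇒headAtLeast k [] _ = tt
All⇒headAtLeast k (a ∷ _) (k≤a ∷ _) = ≤⇒≤ᵇ k≤a

PT-≡ : ∀ {k N M} (x y : PT k N M) → proj₁ x ≡ proj₁ y → x ≡ y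
PT-≡ (ps , i , a , l , s) (.ps , i′ , a′ , l′ , s′) refl
  rewrite T-irrelevant i i′ | All.irrelevant ≤-irrelevant a a′ | ≡-irrelevant l l′ | ≡-irrelevant s s′ = refl

PT↔Ptn : ∀ k {N M} → PT (suc k) N M ↔ Ptn (suc k) N M
PT↔Ptn k = mk↔ₛ′ to from (λ (qs , _) → Sized-≡ _ _ (reverse-involutive qs)) (λ (ps , _) → PT-≡ _ _ (reverse-involutive ps))
  where
  reversed : ∀ {N M} ps → length ps ≡ N → sum ps ≡ M → length (reverse ps) ≡ N × sum (reverse ps) ≡ M
  reversed ps l s = trans (length-reverse ps) l , trans (sum-↭ (↭-reverse ps)) s
  to : ∀ {N M} → PT (suc k) N M → Ptn (suc k) N M
  to (ps , i , a , l , s) = reverse ps ,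
    ∧-intro (subst T (sym (ascending-reverse ps)) (inPT⇒descending ps i)) (All⇒headAtLeast (suc k) (reverse ps) (All-reverse ps a)) ,
    reversed ps l s
  from : ∀ {N M} → Ptn (suc k) N M → PT (suc k) N M
  from (qs , q , l , s) = reverse qs ,
    descending⇒inPT (reverse qs) (All.map (≤-trans (s≤s z≤n)) parts) (subst T (sym (descending-reverse qs)) (∧-fst q)) ,
    parts , reversed qs l s
    where parts = All-reverse qs (asc⇒All (suc k) qs q)

after-unrepeatable : ∀ m b c → m ≤ b → T (pairOK c b) → ¬ T (pairOK m m) → m < c
after-unrepeatable m b c m≤b t ¬mm with m≤n⇒m<n∨m≡n m≤b
... | inj₁ m<b = <-≤-trans m<b (pairOK-≤ b c t)
... | inj₂ refl with m≤n⇒m<n∨m≡n (pairOK-≤ m c t)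
...   | inj₁ m<c = m<c
...   | inj₂ refl = contradiction t ¬mm

ascending-next : ∀ m b r → T (ascending (b ∷ r)) → m ≤ b → ¬ T (pairOK m m) → T (headAtLeast (suc m) r)
ascending-next m b [] _ _ _ = tt
ascending-next m b (c ∷ r) t m≤b ¬mm = ≤⇒≤ᵇ (after-unrepeatable m b c m≤b (linksUp-first b c r (∧-fst t)) ¬mm)

ascending-next-weak : ∀ m b r → T (ascending (b ∷ r)) → m ≤ b → T (headAtLeast m r)
ascending-next-weak m b [] _ _ = tt
ascending-next-weak m b (c ∷ r) t m≤b = ≤⇒≤ᵇ (≤-trans m≤b (pairOK-≤ b c (linksUp-first b c r (∧-fst t))))

linksUp-prepend : ∀ a b r → a + 2 ≤ b → T (headAtLeast (a + 3) r) → T (linksUp a (b ∷ r))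
linksUp-prepend a b [] a+2≤b _ = pairOK-far a b a+2≤b
linksUp-prepend a b (c ∷ r) a+2≤b h = ∧-intro (pairOK-far a b a+2≤b) h

asc-succ : ∀ k ps → T (asc k ps ∧ headNot k ps) ⇔ T (asc (suc k) ps)
asc-succ k [] = mk⇔ (λ _ → tt) (λ _ → tt)
asc-succ k (a ∷ r) = mk⇔ to from
  where
  to : T (asc k (a ∷ r) ∧ headNot k (a ∷ r)) → T (asc (suc k) (a ∷ r))
  to t with asc-∷⁻ k a r (∧-fst t)
  ... | k≤a , l , ar = asc-∷⁺ (suc k) a r (≤∧≢⇒< k≤a (≢-sym (headNot⇒≢ (∧-snd {asc k (a ∷ r)} t)))) l ar
  from : T (asc (suc k) (a ∷ r)) → T (asc k (a ∷ r) ∧ headNot k (a ∷ r))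
  from t with asc-∷⁻ (suc k) a r t
  ... | k<a , l , ar = ∧-intro (asc-∷⁺ k a r (<⇒≤ k<a) l ar) (headNot-≢ (>⇒≢ k<a))

-- Bounds on the part b after a smallest part a = 1, 2, 3: condition (ii) rules out b ≤ a + 1 unless
-- 3 ∣ a + b, and the remaining small values are excluded by hypothesis.
after₁ : ∀ b → T (pairOK b 1) → b ≢ 2 → b ≢ 3 → 4 ≤ b
after₁ 2 _ b≢2 _ = contradiction refl b≢2
after₁ 3 _ _ b≢3 = contradiction refl b≢3
after₁ (suc (suc (suc (suc b)))) _ _ _ = s≤s (s≤s (s≤s (s≤s z≤n)))

after₂ : ∀ b → T (pairOK b 2) → 4 ≤ b
after₂ (suc (suc (suc (suc b)))) _ = s≤s (s≤s (s≤s (s≤s z≤n)))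

after₃ : ∀ b → T (pairOK b 3) → b ≢ 3 → 5 ≤ b
after₃ 3 _ b≢3 = contradiction refl b≢3
after₃ (suc (suc (suc (suc (suc b))))) _ _ = s≤s (s≤s (s≤s (s≤s (s≤s z≤n))))

tail₂ : ∀ r → T (asc 2 (2 ∷ r)) ⇔ T (asc 4 r)
tail₂ [] = mk⇔ (λ _ → tt) (λ _ → tt)
tail₂ (b ∷ r) = mk⇔ to from
  where
  to : T (asc 2 (2 ∷ b ∷ r)) → T (asc 4 (b ∷ r))
  to t with asc-∷⁻ 2 2 (b ∷ r) t
  ... | _ , l , br = ∧-intro br (≤⇒≤ᵇ (after₂ b (linksUp-first 2 b r l)))
  from : T (asc 4 (b ∷ r)) → T (asc 2 (2 ∷ b ∷ r))
  from t with asc-∷⁻ 4 b r t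
  ... | 4≤b , _ , _ = asc-∷⁺ 2 2 (b ∷ r) ≤-refl (linksUp-prepend 2 b r 4≤b (ascending-next 4 b r br 4≤b λ ())) br
    where br = ∧-fst t

tail₃-other : ∀ r → T (asc 3 (3 ∷ r) ∧ headNot 3 r) ⇔ T (asc 5 r)
tail₃-other [] = mk⇔ (λ _ → tt) (λ _ → tt)
tail₃-other (b ∷ r) = mk⇔ to from
  where
  to : T (asc 3 (3 ∷ b ∷ r) ∧ headNot 3 (b ∷ r)) → T (asc 5 (b ∷ r))
  to t with asc-∷⁻ 3 3 (b ∷ r) (∧-fst t)
  ... | _ , l , br = ∧-intro br (≤⇒≤ᵇ (after₃ b (linksUp-first 3 b r l) (headNot⇒≢ (∧-snd {asc 3 (3 ∷ b ∷ r)} t))))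
  from : T (asc 5 (b ∷ r)) → T (asc 3 (3 ∷ b ∷ r) ∧ headNot 3 (b ∷ r))
  from t with asc-∷⁻ 5 b r t
  ... | 5≤b , _ , _ =
    ∧-intro (asc-∷⁺ 3 3 (b ∷ r) ≤-refl (linksUp-prepend 3 b r 5≤b (ascending-next 5 b r br 5≤b λ ())) br)
            (headNot-≢ (>⇒≢ (≤-trans (n≤1+n 4) 5≤b)))
    where br = ∧-fst t

tail₃-repeat : ∀ r → T (asc 3 (3 ∷ 3 ∷ r)) ⇔ T (asc 6 r)
tail₃-repeat [] = mk⇔ (λ _ → tt) (λ _ → tt)
tail₃-repeat (c ∷ r) = mk⇔ to from
  where
  to : T (asc 3 (3 ∷ 3 ∷ c ∷ r)) → T (asc 6 (c ∷ r))
  to t with asc-∷⁻ 3 3 (3 ∷ c ∷ r) t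
  ... | _ , 6≤c , 3cr = ∧-intro (∧-snd {linksUp 3 (c ∷ r)} 3cr) 6≤c
  from : T (asc 6 (c ∷ r)) → T (asc 3 (3 ∷ 3 ∷ c ∷ r))
  from t with asc-∷⁻ 6 c r t
  ... | 6≤c , _ , _ = asc-∷⁺ 3 3 (3 ∷ c ∷ r) ≤-refl (≤⇒≤ᵇ 6≤c)
                        (∧-intro (linksUp-prepend 3 c r (≤-trans (n≤1+n 5) 6≤c) (ascending-next-weak 6 c r cr 6≤c)) cr)
    where cr = ∧-fst t

tail₁-two : ∀ r → T (asc 1 (1 ∷ 2 ∷ r)) ⇔ T (asc 4 r)
tail₁-two r = mk⇔ to from
  where
  to : T (asc 1 (1 ∷ 2 ∷ r)) → T (asc 4 r)
  to t with asc-∷⁻ 1 1 (2 ∷ r) t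
  ... | _ , _ , 2r = Equivalence.to (tail₂ r) (∧-intro 2r tt)
  links : ∀ r → T (asc 4 r) → T (linksUp 1 (2 ∷ r))
  links [] _ = tt
  links (c ∷ r) t = ∧-snd {ascending (c ∷ r)} t
  from : T (asc 4 r) → T (asc 1 (1 ∷ 2 ∷ r))
  from t = asc-∷⁺ 1 1 (2 ∷ r) ≤-refl (links r t) (∧-fst (Equivalence.from (tail₂ r) t))

tail₁-three : ∀ r → T (asc 1 (1 ∷ 3 ∷ r) ∧ headNot 2 (3 ∷ r)) ⇔ T (asc 5 r)
tail₁-three r = mk⇔ to from
  where
  not3 : ∀ r → T (linksUp 1 (3 ∷ r)) → T (headNot 3 r)
  not3 [] _ = tt
  not3 (c ∷ r) l = headNot-≢ (>⇒≢ (≤ᵇ⇒≤ 4 c l))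
  to : T (asc 1 (1 ∷ 3 ∷ r) ∧ true) → T (asc 5 r)
  to t with asc-∷⁻ 1 1 (3 ∷ r) (∧-fst t)
  ... | _ , l , 3r = Equivalence.to (tail₃-other r) (∧-intro (∧-intro 3r tt) (not3 r l))
  links : ∀ r → T (asc 5 r) → T (linksUp 1 (3 ∷ r))
  links [] _ = tt
  links (c ∷ r) t = ≤⇒≤ᵇ (≤-trans (n≤1+n 4) (≤ᵇ⇒≤ 5 c (∧-snd {ascending (c ∷ r)} t)))
  from : T (asc 5 r) → T (asc 1 (1 ∷ 3 ∷ r) ∧ true)
  from t = ∧-intro (asc-∷⁺ 1 1 (3 ∷ r) ≤-refl (links r t) (∧-fst (∧-fst (Equivalence.from (tail₃-other r) t)))) tt

tail₁-rest : ∀ r → T ((asc 1 (1 ∷ r) ∧ headNot 2 r) ∧ headNot 3 r) ⇔ T (asc 4 r)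
tail₁-rest [] = mk⇔ (λ _ → tt) (λ _ → tt)
tail₁-rest (b ∷ r) = mk⇔ to from
  where
  to : T ((asc 1 (1 ∷ b ∷ r) ∧ headNot 2 (b ∷ r)) ∧ headNot 3 (b ∷ r)) → T (asc 4 (b ∷ r))
  to t with asc-∷⁻ 1 1 (b ∷ r) (∧-fst (∧-fst t))
  ... | _ , l , br = ∧-intro br (≤⇒≤ᵇ (after₁ b (linksUp-first 1 b r l)
                       (headNot⇒≢ (∧-snd {asc 1 (1 ∷ b ∷ r)} (∧-fst t))) (headNot⇒≢ (∧-snd {asc 1 (1 ∷ b ∷ r) ∧ headNot 2 (b ∷ r)} t))))
  from : T (asc 4 (b ∷ r)) → T ((asc 1 (1 ∷ b ∷ r) ∧ headNot 2 (b ∷ r)) ∧ headNot 3 (b ∷ r))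
  from t with asc-∷⁻ 4 b r t
  ... | 4≤b , _ , _ = ∧-intro (∧-intro (asc-∷⁺ 1 1 (b ∷ r) ≤-refl (linksUp-prepend 1 b r (≤-trans (n≤1+n 3) 4≤b) (ascending-next-weak 4 b r br 4≤b)) br)
                                        (headNot-≢ (>⇒≢ (≤-trans (n≤1+n 3) 4≤b))))
                              (headNot-≢ (>⇒≢ 4≤b))
    where br = ∧-fst t

_⊎ᶠ_ : (ℕ → ℕ → Set) → (ℕ → ℕ → Set) → ℕ → ℕ → Set
(F ⊎ᶠ G) N M = F N M ⊎ G N M

Ptn-split : ∀ k {N M} → Ptn k N M ↔ (Ptn (suc k) N M ⊎ XQ 1 k (Sized (asc k ∘ (k ∷_))) N M)
Ptn-split k = ↔-trans (Sized-split k) (Sized-equiv (asc-succ k) ⊎-↔ ↔-refl)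

-- G₁ = G₂ + x q ((G₄ + x q³ G₅) + x q² G₄): after a smallest part 1 come parts ≥ 4,
-- or a part 3 and then parts ≥ 5, or a part 2 and then parts ≥ 4.
Ptn₁-split : ∀ {N M} → Ptn 1 N M ↔ (Ptn 2 N M ⊎ XQ 1 1 ((Ptn 4 ⊎ᶠ XQ 1 3 (Ptn 5)) ⊎ᶠ XQ 1 2 (Ptn 4)) N M)
Ptn₁-split = ↔-trans (Ptn-split 1) (↔-refl ⊎-↔ XQ-cong λ _ _ →
  ↔-trans (Sized-split 2)
    (↔-trans (Sized-split 3) (Sized-equiv tail₁-rest ⊎-↔ XQ-cong λ _ _ → Sized-equiv tail₁-three)
      ⊎-↔ XQ-cong λ _ _ → Sized-equiv tail₁-two))

Ptn₂-split : ∀ {N M} → Ptn 2 N M ↔ (Ptn 3 N M ⊎ XQ 1 2 (Ptn 4) N M)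
Ptn₂-split = ↔-trans (Ptn-split 2) (↔-refl ⊎-↔ XQ-cong λ _ _ → Sized-equiv tail₂)

Ptn₃-split : ∀ {N M} → Ptn 3 N M ↔ (Ptn 4 N M ⊎ XQ 1 3 (Ptn 5 ⊎ᶠ XQ 1 3 (Ptn 6)) N M)
Ptn₃-split = ↔-trans (Ptn-split 3) (↔-refl ⊎-↔ XQ-cong λ _ _ →
  ↔-trans (Sized-split 3) (Sized-equiv tail₃-other ⊎-↔ XQ-cong λ _ _ → Sized-equiv tail₃-repeat))

raise : List ℕ → List ℕ
raise = map (3 +_)

residue-+6 : ∀ b a → (3 + b + (3 + a)) % 3 ≡ (b + a) % 3
residue-+6 b a = trans (cong (_% 3) (regroup b a)) ([m+kn]%n≡m%n (b + a) 2 3)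
  where
  regroup : ∀ b a → 3 + b + (3 + a) ≡ b + a + 2 * 3
  regroup = solve-∀

pairOK-+3 : ∀ a b → pairOK (3 + b) (3 + a) ≡ pairOK b a
pairOK-+3 a b rewrite ≤ᵇ-+ 3 a b | ≤ᵇ-+ 3 b (a + 1) | residue-+6 b a = refl

linksUp-raise : ∀ a r → linksUp (3 + a) (raise r) ≡ linksUp a r
linksUp-raise a [] = refl
linksUp-raise a (b ∷ []) = pairOK-+3 a b
linksUp-raise a (b ∷ c ∷ _) = cong₂ _∧_ (pairOK-+3 a b) (≤ᵇ-+ 3 (a + 3) c)

ascending-raise : ∀ r → ascending (raise r) ≡ ascending r
ascending-raise [] = refl
ascending-raise (a ∷ r) = cong₂ _∧_ (linksUp-raise a r) (ascending-raise r)

asc-raise : ∀ k r → asc (3 + k) (raise r) ≡ asc k r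
asc-raise k [] = refl
asc-raise k (a ∷ r) = cong₂ _∧_ (ascending-raise (a ∷ r)) (≤ᵇ-+ 3 k a)

sum-raise : ∀ r → sum (raise r) ≡ 3 * length r + sum r
sum-raise [] = refl
sum-raise (a ∷ r) = trans (cong (3 + a +_) (sum-raise r)) (regroup a (length r) (sum r))
  where
  regroup : ∀ a n s → 3 + a + (3 * n + s) ≡ 3 * suc n + (a + s)
  regroup = solve-∀

Ptn-raise : ∀ k {N M} → Ptn (3 + k) N M ↔ XQ 0 (3 * N) (Ptn k) N M
Ptn-raise k {N} {M} = mk↔ₛ′ to from (λ (_ , _ , _ , _ , y) → XQ-Sized-≡ _ y (lower-raise (proj₁ y)))
                                     (λ x@(ps , t , _) → Sized-≡ (from (to x)) x (raise-lower ps t))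
  where
  lower : List ℕ → List ℕ
  lower = map (_∸ 3)
  lower-raise : ∀ r → lower (raise r) ≡ r
  lower-raise r = trans (sym (map-∘ r)) (map-id r)
  raise-lower : ∀ ps → T (asc (3 + k) ps) → raise (lower ps) ≡ ps
  raise-lower ps t = trans (sym (map-∘ ps)) (map-id-local (All.map (m+[n∸m]≡n ∘ ≤-trans (m≤m+n 3 k)) (asc⇒All (3 + k) ps t)))
  to : Ptn (3 + k) N M → XQ 0 (3 * N) (Ptn k) N M
  to (ps , t , l , s) = N , sum (lower ps) , refl , size , lower ps , lowered , trans (length-map _ ps) l , refl
    where
    lowered : T (asc k (lower ps))
    lowered = subst T (trans (cong (asc (3 + k)) (sym (raise-lower ps t))) (asc-raise k (lower ps))) t
    size : 3 * N + sum (lower ps) ≡ M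
    size = begin
      3 * N + sum (lower ps)
        ≡⟨ cong (λ n → 3 * n + sum (lower ps)) (trans (sym l) (sym (length-map _ ps))) ⟩
      3 * length (lower ps) + sum (lower ps)
        ≡⟨ sym (sum-raise (lower ps)) ⟩
      sum (raise (lower ps))
        ≡⟨ cong sum (raise-lower ps t) ⟩
      sum ps
        ≡⟨ s ⟩
      M ∎
      where open ≡-Reasoning
  from : XQ 0 (3 * N) (Ptn k) N M → Ptn (3 + k) N M
  from (N′ , M′ , e₁ , e₂ , r , t , l , s) =
    raise r , subst T (sym (asc-raise k r)) t , trans (length-map _ r) length-r ,
    trans (sum-raise r) (trans (cong₂ (λ n m → 3 * n + m) length-r s) e₂)
    where length-r = trans l e₁

Sized-nil : ∀ {P} → T (P []) → ∀ M → Fin (one M) ↔ Sized P 0 M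
Sized-nil p zero = mk↔ₛ′ (λ _ → [] , p , refl , refl) (λ _ → zero)
                         (λ { ([] , _ , refl , refl) → Sized-≡ _ _ refl }) (λ { zero → refl })
Sized-nil p (suc M) = mk↔ₛ′ (λ ()) (λ { ([] , _ , _ , ()) }) (λ { ([] , _ , _ , ()) }) (λ ())

Fin-≡ : ∀ {a b} → a ≡ b → Fin a ↔ Fin b
Fin-≡ refl = ↔-refl

Fin-+ : ∀ {a b} {A B : Set} → Fin a ↔ A → Fin b ↔ B → Fin (a + b) ↔ (A ⊎ B)
Fin-+ a↔A b↔B = ↔-trans +↔⊎ (a↔A ⊎-↔ b↔B)

xq↔XQ : ∀ dN dM f F N M → (∀ N′ M′ → dN + N′ ≡ N → dM + M′ ≡ M → Fin (f N′ M′) ↔ F N′ M′) →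
        Fin (xq dN dM f N M) ↔ XQ dN dM F N M
xq↔XQ (suc dN) dM f F zero M _ = XQ-empty₁ dN dM F M
xq↔XQ (suc dN) dM f F (suc N) M h = ↔-trans (xq↔XQ dN dM f F N M λ N′ M′ e₁ e₂ → h N′ M′ (cong suc e₁) e₂) (XQ-suc₁ dN dM F N M)
xq↔XQ zero (suc dM) f F N zero _ = XQ-empty₂ dM F N
xq↔XQ zero (suc dM) f F N (suc M) h = ↔-trans (xq↔XQ zero dM f F N M λ N′ M′ e₁ e₂ → h N′ M′ e₁ (cong suc e₂)) (XQ-suc₂ dM F N M)
xq↔XQ zero zero f F N M h = ↔-trans (h N M refl refl) (XQ-zero F N M)

_counts_below_ : (ℕ → ℕ → ℕ) → (ℕ → ℕ → Set) → ℕ → Set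
f counts F below M = ∀ N {M′} → M′ < M → Fin (f N M′) ↔ F N M′

counts-+ᶜ : ∀ {f g F G M} → f counts F below M → g counts G below M → (f +ᶜ g) counts (F ⊎ᶠ G) below M
counts-+ᶜ f↔F g↔G N M′<M = Fin-+ (f↔F N M′<M) (g↔G N M′<M)

counts-xq : ∀ dN dM {f F M} → f counts F below M → xq dN dM f counts XQ dN dM F below M
counts-xq dN dM {f} {F} f↔F N {M′} M′<M =
  xq↔XQ dN dM f F N M′ λ N″ M″ _ e → f↔F N″ (≤-<-trans (m≤n+m M″ dM) (subst (_< _) (sym e) M′<M))

-- Multiplying by a positive power of q reaches size M from sizes below M.
xq-counts : ∀ dN dM {f F M} → f counts F below M → ∀ N → Fin (xq dN (suc dM) f N M) ↔ XQ dN (suc dM) F N M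
xq-counts dN dM {f} {F} {M} f↔F N = xq↔XQ dN (suc dM) f F N M λ N′ M′ _ e → f↔F N′ (subst (M′ <_) e (s≤s (m≤n+m M′ dM)))

record Counted (N M : ℕ) : Set where
  field
    c₁ : Fin (R₁ N M) ↔ Ptn 1 N M
    c₂ : Fin (R₂ N M) ↔ Ptn 2 N M
    c₃ : Fin (R₃ N M) ↔ Ptn 3 N M
    c₄ : Fin (R₄ N M) ↔ Ptn 4 N M
    c₅ : Fin (R₅ N M) ↔ Ptn 5 N M
    c₆ : Fin (R₆ N M) ↔ Ptn 6 N M
open Counted

counted-empty : ∀ M → Counted 0 M
counted-empty M = record
  { c₁ = empty 0 0 ; c₂ = empty 1 3 ; c₃ = empty 2 3 ; c₄ = empty 3 6 ; c₅ = empty 4 9 ; c₆ = empty 5 9 }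
  where
  empty : ∀ a b {k} → Fin (R a b 0 M) ↔ Ptn k 0 M
  empty a b = ↔-trans (Fin-≡ (R-empty a b M)) (Sized-nil tt M)

-- With N ≥ 1 parts, the shifts G_{k+3}(x,q) = G_k(xq³,q) reduce G₄, G₅, G₆ to smaller sizes, and then
-- the recurrences for G₃, G₂, G₁ reduce them to the previous ones and to smaller sizes.
counted-step : ∀ M N → (∀ {M′} → M′ < M → ∀ N → Counted N M′) → Counted (suc N) M
counted-step M N′ ih = record { c₁ = C₁ ; c₂ = C₂ ; c₃ = C₃ ; c₄ = C₄ ; c₅ = C₅ ; c₆ = C₆ }
  where
  N = suc N′
  below : ∀ {f F} → (∀ {N M} → Counted N M → Fin (f N M) ↔ F N M) → f counts F below M
  below count N M′<M = count (ih M′<M N)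
  C₄ : Fin (R₄ N M) ↔ Ptn 4 N M
  C₄ = ↔-trans (Fin-≡ (R-raise 0 0 N M)) (↔-trans (xq-counts 0 _ (below c₁) N) (↔-sym (Ptn-raise 1)))
  C₅ : Fin (R₅ N M) ↔ Ptn 5 N M
  C₅ = ↔-trans (Fin-≡ (R-raise 1 3 N M)) (↔-trans (xq-counts 0 _ (below c₂) N) (↔-sym (Ptn-raise 2)))
  C₆ : Fin (R₆ N M) ↔ Ptn 6 N M
  C₆ = ↔-trans (Fin-≡ (R-raise 2 3 N M)) (↔-trans (xq-counts 0 _ (below c₃) N) (↔-sym (Ptn-raise 3)))
  C₃ : Fin (R₃ N M) ↔ Ptn 3 N M
  C₃ = ↔-trans (Fin-≡ (R₃-split N M))
      (↔-trans (Fin-+ C₄ (xq-counts 1 2 (counts-+ᶜ (below c₅) (counts-xq 1 3 (below c₆))) N)) (↔-sym Ptn₃-split))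
  C₂ : Fin (R₂ N M) ↔ Ptn 2 N M
  C₂ = ↔-trans (Fin-≡ (R₂-split N M)) (↔-trans (Fin-+ C₃ (xq-counts 1 1 (below c₄) N)) (↔-sym Ptn₂-split))
  C₁ : Fin (R₁ N M) ↔ Ptn 1 N M
  C₁ = ↔-trans (Fin-≡ (R₁-split N M))
      (↔-trans (Fin-+ C₂ (xq-counts 1 0 (counts-+ᶜ (counts-+ᶜ (below c₄) (counts-xq 1 3 (below c₅))) (counts-xq 1 2 (below c₄))) N))
               (↔-sym Ptn₁-split))

all-counted : ∀ M N → Counted N M
all-counted = <-rec (λ M → ∀ N → Counted N M) λ where
  M ih zero → counted-empty M
  M ih (suc N) → counted-step M N ih

mainTheorem1 : Identity 1 ex₁ × Identity 2 ex₂ × Identity 3 ex₃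
mainTheorem1 = identity 0 0 0 ex₁ form₁ c₁ , identity 1 1 3 ex₂ form₂ c₂ , identity 2 2 3 ex₃ form₃ c₃
  where
  identity : ∀ k a b e → (∀ n₁ n₂ → e n₁ n₂ ≡ ex a b n₁ n₂) → (∀ {N M} → Counted N M → Fin (R a b N M) ↔ Ptn (suc k) N M) →
             Identity (suc k) e
  identity k a b e e≡ex count N M =
    ↔-trans (Fin-≡ (rhsCoeff-R e a b e≡ex N M)) (↔-trans (count (all-counted M N)) (↔-sym (PT↔Ptn k)))
  form₁ : ∀ n₁ n₂ → n₁ * n₁ + 3 * n₂ * n₂ + 3 * n₁ * n₂ ≡ n₁ * n₁ + 3 * n₂ * n₂ + 3 * n₁ * n₂ + 0 * n₁ + 0 * n₂
  form₁ = solve-∀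
  form₂ : ∀ n₁ n₂ → n₁ * n₁ + 3 * n₂ * n₂ + 3 * n₁ * n₂ + n₁ + 3 * n₂
                  ≡ n₁ * n₁ + 3 * n₂ * n₂ + 3 * n₁ * n₂ + 1 * n₁ + 3 * n₂
  form₂ = solve-∀
  form₃ : ∀ n₁ n₂ → ex₃ n₁ n₂ ≡ ex 2 3 n₁ n₂
  form₃ n₁ n₂ = refl
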